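{- Let $1\le r\le n$, and for a loopfree matroid $M$ of rank $r$ on $[n]$ let $f_k(M;s,c)$ be the number of flats $F$ of $M$ with $|F|=s$, $\mathrm{rank}_M(F)=k$ such that the restriction $M|_F$ has exactly $c$ coloops. For fixed $k,s,c$, the map $M\mapsto f_k(M;s,c)$ induces a well-defined $\mathbb{Z}$-module homomorphism $\mathbb{M}_{r,n}\to\mathbb{Z}$. In particular, the number of flats of rank $k$ and the number of cyclic flats of rank $k$ induce $\mathbb{Z}$-module homomorphisms $\mathbb{M}_{r,n}\to\mathbb{Z}$.
   Context: $\mathbb{M}_{r,n}$: the free $\mathbb{Z}$-module on loopfree rank-$r$ matroids on $[n]$ modulo the kernel of the map $M\mapsto v_M\in\mathbb{Z}^{\mathfrak{C}_{r,n}}$, where $\mathfrak{C}_{r,n}$ is the set of chains $\emptyset\subsetneq F_1\subsetneq\dots\subsetneq F_r=[n]$ and $(v_M)_{\mathcal{C}}=1$ if $\mathcal{C}$ consists of flats of $M$, $0$ otherwise. A cyclic flat is a flat that is a union of circuits. -}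

module Defs where

open import Data.Nat as ℕ using (ℕ; zero; suc; _+_; _≤_; _<_; _<?_; _≟_)
open import Data.Integer as ℤ using (ℤ; +_)
open import Data.Fin using (Fin; toℕ)
open import Data.Fin.Properties using (all?; any?)
open import Data.Fin.Subset using (Subset; _∈_; _∉_; _⊆_; _⊂_; _∪_; _∩_; _-_; ⁅_⁆; ∣_∣; ⊥; ⊤; inside; outside)
open import Data.Fin.Subset.Properties using (_∈?_; _⊆?_; anySubset?)
open import Data.Vec using ([]; _∷_)
import Data.List
open import Data.List using (List; map; sum; filter; length; allFin)
open import Data.Product using (_×_; _,_; ∃)
open import Data.Bool using (if_then_else_)
open import Relation.Nullary using (Dec; does; ¬?; _×-dec_; _→-dec_)
open import Relation.Unary using (Pred; Decidable)
open import Relation.Binary.PropositionalEquality using (_≡_)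

record Matroid (n : ℕ) : Set where
  field
    rk        : Subset n → ℕ
    rk-bound  : ∀ X → rk X ≤ ∣ X ∣
    rk-mono   : ∀ X Y → X ⊆ Y → rk X ≤ rk Y
    rk-submod : ∀ X Y → rk (X ∪ Y) + rk (X ∩ Y) ≤ rk X + rk Y
open Matroid public

record LoopfreeMatroid (r n : ℕ) : Set where
  field
    mat      : Matroid n
    loopfree : ∀ (e : Fin n) → rk mat ⁅ e ⁆ ≡ 1
    rank-r   : rk mat ⊤ ≡ r
open LoopfreeMatroid public

module _ {n : ℕ} (M : Matroid n) where

  IsFlat : Subset n → Set
  IsFlat F = ∀ e → e ∉ F → rk M F < rk M (F ∪ ⁅ e ⁆)

  isFlat? : Decidable IsFlat
  isFlat? F = all? (λ e → ¬? (e ∈? F) →-dec (rk M F <? rk M (F ∪ ⁅ e ⁆)))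

  IsColoopOfRestr : Subset n → Fin n → Set
  IsColoopOfRestr F e = e ∈ F × rk M (F - e) < rk M F

  isColoopOfRestr? : ∀ F → Decidable (IsColoopOfRestr F)
  isColoopOfRestr? F e = (e ∈? F) ×-dec (rk M (F - e) <? rk M F)

  numColoops : Subset n → ℕ
  numColoops F = length (filter (isColoopOfRestr? F) (allFin n))

  IsCircuit : Subset n → Set
  IsCircuit C = rk M C < ∣ C ∣ × (∀ e → e ∈ C → rk M (C - e) ≡ ∣ C - e ∣)

  isCircuit? : Decidable IsCircuit
  isCircuit? C = (rk M C <? ∣ C ∣)
    ×-dec all? (λ e → (e ∈? C) →-dec (rk M (C - e) ≟ ∣ C - e ∣))

  IsUnionOfCircuits : Subset n → Set
  IsUnionOfCircuits F = ∀ e → e ∈ F → ∃ λ C → C ⊆ F × e ∈ C × IsCircuit C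

  isUnionOfCircuits? : Decidable IsUnionOfCircuits
  isUnionOfCircuits? F = all? (λ e → (e ∈? F) →-dec
    anySubset? (λ C → (C ⊆? F) ×-dec (e ∈? C) ×-dec isCircuit? C))

  IsCyclicFlat : Subset n → Set
  IsCyclicFlat F = IsFlat F × IsUnionOfCircuits F

  isCyclicFlat? : Decidable IsCyclicFlat
  isCyclicFlat? F = isFlat? F ×-dec isUnionOfCircuits? F

countSubsets : ∀ {n} {P : Pred (Subset n) Agda.Primitive.lzero} → Decidable P → ℕ
countSubsets {zero}  P? = if does (P? []) then 1 else 0
countSubsets {suc n} P? = countSubsets (λ X → P? (inside ∷ X))
                        + countSubsets (λ X → P? (outside ∷ X))

f : ∀ {n} → ℕ → ℕ → ℕ → Matroid n → ℕ
f k s c M = countSubsets (λ F → isFlat? M F ×-dec (∣ F ∣ ≟ s)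
                               ×-dec (rk M F ≟ k) ×-dec (numColoops M F ≟ c))

numFlats : ∀ {n} → ℕ → Matroid n → ℕ
numFlats k M = countSubsets (λ F → isFlat? M F ×-dec (rk M F ≟ k))

numCyclicFlats : ∀ {n} → ℕ → Matroid n → ℕ
numCyclicFlats k M = countSubsets (λ F → isCyclicFlat? M F ×-dec (rk M F ≟ k))

-- Chains ∅ ⊊ F₁ ⊊ … ⊊ F_r = [n], indexed by Fin r (F_{i+1} = C i).

record IsChain {r n : ℕ} (C : Fin r → Subset n) : Set where
  field
    first-nonempty : ∀ i → toℕ i ≡ 0 → ⊥ ⊂ C i
    strict-incr    : ∀ i j → toℕ i < toℕ j → C i ⊂ C j
    last-full      : ∀ i → suc (toℕ i) ≡ r → C i ≡ ⊤

vCoord : ∀ {r n} → Matroid n → (Fin r → Subset n) → ℤ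
vCoord M C = if does (all? (λ i → isFlat? M (C i))) then + 1 else + 0

sumℤ : List ℤ → ℤ
sumℤ = Data.List.foldr ℤ._+_ (+ 0)

LinComb : ℕ → ℕ → Set
LinComb r n = List (ℤ × LoopfreeMatroid r n)

InKernel : ∀ {r n} → LinComb r n → Set
InKernel {r} {n} L = ∀ (C : Fin r → Subset n) → IsChain C →
  sumℤ (map (λ { (a , M) → a ℤ.* vCoord (mat M) C }) L) ≡ + 0

-- g : matroids → ℤ induces a well-defined ℤ-module map 𝕄_{r,n} → ℤ
-- (the linear extension vanishes on the kernel)
InducesHom : ∀ r n → (Matroid n → ℕ) → Set
InducesHom r n g = ∀ (L : LinComb r n) → InKernel L →
  sumℤ (map (λ { (a , M) → a ℤ.* + g (mat M) }) L) ≡ + 0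

module Submission where

open import Defs
open import Data.Nat using (ℕ; _≤_)
open import Data.Product using (_×_)

open import Function using (_∘_)
open import Data.Nat as ℕ using (zero; suc; _+_; _<_; _∸_; z≤n; s≤s; _≤?_; _<?_)
import Data.Nat.Properties as ℕP
open import Data.Integer as ℤ using (ℤ; +_; -_)
import Data.Integer.Properties as ℤP
open import Data.Integer.Tactic.RingSolver using (solve-∀)
open import Data.Fin as Fin using (Fin; toℕ; fromℕ<)
import Data.Fin.Properties as FinP
open import Data.Fin.Properties using (all?)
open import Data.Fin.Subset using (Subset; _∈_; _∉_; _⊆_; _⊂_; _∪_; _∩_; _─_; _-_; ⁅_⁆; ∣_∣; inside; outside; Nonempty)
  renaming (⊥ to ∅; ⊤ to Full)
open import Data.Fin.Subset.Properties using (_⊆?_; _∈?_; nonempty?)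
import Data.Fin.Subset.Properties as SP
open import Data.Vec using (Vec; []; _∷_; lookup; tabulate; here; there)
import Data.Vec.Properties as VecP
open import Data.List using (List; filter; length; allFin; []; _∷_)
import Data.List as List
open import Data.List.Membership.Propositional using () renaming (_∈_ to _∈ₗ_)
import Data.List.Membership.Propositional.Properties as LMP
open import Data.List.Relation.Unary.Any using (here; there)
open import Data.Product using (Σ; ∃; _,_; proj₁; proj₂)
open import Data.Sum using (_⊎_; inj₁; inj₂)
open import Data.Bool as Bool using (Bool; true; false; if_then_else_)
open import Data.Empty renaming (⊥ to False; ⊥-elim to absurd)
open import Relation.Nullary using (Dec; yes; no; does; ¬_; _×-dec_; _⊎-dec_; _→-dec_)
open import Relation.Nullary.Decidable using (dec-true)
open import Relation.Binary.PropositionalEquality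
  using (_≡_; _≢_; refl; sym; trans; cong; cong₂; subst; subst₂; module ≡-Reasoning)

-- Call h : Matroid n → ℤ kernel-linear (in rank r) if Σ aᵢ h(Mᵢ) = 0 for every
-- combination Σ aᵢ Mᵢ of loopfree rank-r matroids in the kernel of M ↦ v_M; these are
-- exactly the functions inducing maps 𝕄_{r,n} → ℤ.  Kernel-linear functions are closed
-- under scaling and finite sums, and each chain coordinate M ↦ (v_M)_𝒞 is kernel-linear
-- by definition.
--
-- For D ⊆ F and d ≤ k, the flag indicator [D is a flat of rank d
--    and F is a flat of rank k] is a sum of chain coordinates: among the flags that
--    move greedily towards the targets D, F, [n] (each step adds a fixed element of
--    the next target) exactly one consists of flats — the one built by closures —
--    and it exists precisely when the indicator is 1.  Ranks 0 and r, where only ∅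
--    and [n] qualify, reduce to constants, which are the case with no targets.
-- 2. Coloops.  If F is a flat of rank k, a set S ⊆ F consists of coloops of M|F iff
--    F ∖ S is a flat of rank k − |S|.  Inclusion–exclusion with the weights
--    (−1)^{m−c} binom(m,c) writes [M|F has c coloops] through flag indicators,
--    which gives f_k(·;s,c); numFlats k is a sum of flag indicators.
-- 3. Cyclic flats are exactly the flats F for which M|F has no coloops, so
--    numCyclicFlats k is the c = 0 expansion summed over all F.

𝟙 : ∀ {P : Set} → Dec P → ℤ
𝟙 d = if does d then + 1 else + 0

𝟙-yes : ∀ {P : Set} (d : Dec P) → P → 𝟙 d ≡ + 1
𝟙-yes (yes _) _ = refl
𝟙-yes (no ¬p) p = absurd (¬p p)

𝟙-no : ∀ {P : Set} (d : Dec P) → ¬ P → 𝟙 d ≡ + 0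
𝟙-no (yes p) ¬p = absurd (¬p p)
𝟙-no (no _) _ = refl

𝟙-⇔ : ∀ {P Q : Set} (p : Dec P) (q : Dec Q) → (P → Q) → (Q → P) → 𝟙 p ≡ 𝟙 q
𝟙-⇔ (yes p) (yes q) to from = refl
𝟙-⇔ (yes p) (no ¬q) to from = absurd (¬q (to p))
𝟙-⇔ (no ¬p) (yes q) to from = absurd (¬p (from q))
𝟙-⇔ (no ¬p) (no ¬q) to from = refl

𝟙-× : ∀ {P Q : Set} (p : Dec P) (q : Dec Q) → 𝟙 (p ×-dec q) ≡ 𝟙 p ℤ.* 𝟙 q
𝟙-× (yes p) (yes q) = refl
𝟙-× (yes p) (no ¬q) = refl
𝟙-× (no ¬p) (yes q) = refl
𝟙-× (no ¬p) (no ¬q) = refl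

sumSubsets : ∀ {n} → (Subset n → ℤ) → ℤ
sumSubsets {zero} g = g []
sumSubsets {suc n} g = sumSubsets (λ X → g (inside ∷ X)) ℤ.+ sumSubsets (λ X → g (outside ∷ X))

sumSubsets-cong : ∀ {n} (g h : Subset n → ℤ) → (∀ X → g X ≡ h X) → sumSubsets g ≡ sumSubsets h
sumSubsets-cong {zero} g h g≡h = g≡h []
sumSubsets-cong {suc n} g h g≡h =
  cong₂ ℤ._+_ (sumSubsets-cong _ _ (λ X → g≡h (inside ∷ X))) (sumSubsets-cong _ _ (λ X → g≡h (outside ∷ X)))

sumSubsets-zero : ∀ {n} (g : Subset n → ℤ) → (∀ X → g X ≡ + 0) → sumSubsets g ≡ + 0
sumSubsets-zero {zero} g g≡0 = g≡0 []
sumSubsets-zero {suc n} g g≡0 =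
  cong₂ ℤ._+_ (sumSubsets-zero _ (λ X → g≡0 (inside ∷ X))) (sumSubsets-zero _ (λ X → g≡0 (outside ∷ X)))

sumSubsets-+ : ∀ {n} (g h : Subset n → ℤ) → sumSubsets (λ X → g X ℤ.+ h X) ≡ sumSubsets g ℤ.+ sumSubsets h
sumSubsets-+ {zero} g h = refl
sumSubsets-+ {suc n} g h = trans
  (cong₂ ℤ._+_ (sumSubsets-+ (λ X → g (inside ∷ X)) (λ X → h (inside ∷ X)))
               (sumSubsets-+ (λ X → g (outside ∷ X)) (λ X → h (outside ∷ X))))
  (interchange (sumSubsets (λ X → g (inside ∷ X))) (sumSubsets (λ X → h (inside ∷ X)))
                (sumSubsets (λ X → g (outside ∷ X))) (sumSubsets (λ X → h (outside ∷ X))))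
  where
  interchange : ∀ a b c d → a ℤ.+ b ℤ.+ (c ℤ.+ d) ≡ a ℤ.+ c ℤ.+ (b ℤ.+ d)
  interchange = solve-∀

sumSubsets-delta : ∀ {n} (g : Subset n → ℤ) (x : Subset n) → (∀ X → X ≢ x → g X ≡ + 0) → sumSubsets g ≡ g x
sumSubsets-delta {zero} g [] _ = refl
sumSubsets-delta {suc n} g (inside ∷ x) off = trans
  (cong₂ ℤ._+_ (sumSubsets-delta _ x (λ X X≢x → off (inside ∷ X) (X≢x ∘ VecP.∷-injectiveʳ)))
               (sumSubsets-zero _ (λ X → off (outside ∷ X) (λ ()))))
  (ℤP.+-identityʳ _)
sumSubsets-delta {suc n} g (outside ∷ x) off = trans
  (cong₂ ℤ._+_ (sumSubsets-zero _ (λ X → off (inside ∷ X) (λ ())))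
               (sumSubsets-delta _ x (λ X X≢x → off (outside ∷ X) (X≢x ∘ VecP.∷-injectiveʳ))))
  (ℤP.+-identityˡ _)

countSubsets≡sum : ∀ {n} {P : Subset n → Set} (P? : ∀ X → Dec (P X)) → + countSubsets P? ≡ sumSubsets (λ X → 𝟙 (P? X))
countSubsets≡sum {zero} P? with does (P? [])
... | true = refl
... | false = refl
countSubsets≡sum {suc n} P? = trans (ℤP.pos-+ (countSubsets (λ X → P? (inside ∷ X))) _)
  (cong₂ ℤ._+_ (countSubsets≡sum (λ X → P? (inside ∷ X))) (countSubsets≡sum (λ X → P? (outside ∷ X))))

sumTuples : ∀ {n} r → (Vec (Subset n) r → ℤ) → ℤ
sumTuples zero g = g []
sumTuples (suc r) g = sumSubsets (λ X → sumTuples r (λ v → g (X ∷ v)))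

sumTuples-zero : ∀ {n} r (g : Vec (Subset n) r → ℤ) → (∀ v → g v ≡ + 0) → sumTuples r g ≡ + 0
sumTuples-zero zero g g≡0 = g≡0 []
sumTuples-zero (suc r) g g≡0 = sumSubsets-zero _ (λ X → sumTuples-zero r _ (λ v → g≡0 (X ∷ v)))

sumTuples-delta : ∀ {n} r (g : Vec (Subset n) r → ℤ) (x : Vec (Subset n) r) →
  (∀ v → v ≢ x → g v ≡ + 0) → sumTuples r g ≡ g x
sumTuples-delta zero g [] _ = refl
sumTuples-delta (suc r) g (x ∷ xs) off = trans
  (sumSubsets-delta _ x (λ X X≢x → sumTuples-zero r _ (λ v → off (X ∷ v) (X≢x ∘ VecP.∷-injectiveˡ))))
  (sumTuples-delta r _ xs (λ v v≢xs → off (x ∷ v) (v≢xs ∘ VecP.∷-injectiveʳ)))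

evalComb : ∀ {r n} → LinComb r n → (Matroid n → ℤ) → ℤ
evalComb [] h = + 0
evalComb ((a , M) ∷ L) h = a ℤ.* h (mat M) ℤ.+ evalComb L h

KernelLinear : ℕ → (n : ℕ) → (Matroid n → ℤ) → Set
KernelLinear r n h = ∀ (L : LinComb r n) → InKernel L → evalComb L h ≡ + 0

KernelLinear-ext : ∀ {r n} (h h' : Matroid n → ℤ) → (∀ (M : LoopfreeMatroid r n) → h (mat M) ≡ h' (mat M)) →
  KernelLinear r n h → KernelLinear r n h'
KernelLinear-ext {r} {n} h h' h≡h' lin L inK = trans (sym (evalComb-ext L)) (lin L inK)
  where
  evalComb-ext : ∀ (L : LinComb r n) → evalComb L h ≡ evalComb L h'
  evalComb-ext [] = refl
  evalComb-ext ((a , M) ∷ L) = cong₂ (λ u w → a ℤ.* u ℤ.+ w) (h≡h' M) (evalComb-ext L)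

KernelLinear-zero : ∀ {r n} → KernelLinear r n (λ _ → + 0)
KernelLinear-zero L _ = evalComb-zero L
  where
  evalComb-zero : ∀ {r n} (L : LinComb r n) → evalComb L (λ _ → + 0) ≡ + 0
  evalComb-zero [] = refl
  evalComb-zero ((a , M) ∷ L) = cong₂ ℤ._+_ (ℤP.*-zeroʳ a) (evalComb-zero L)

KernelLinear-scale : ∀ {r n} (c : ℤ) (h : Matroid n → ℤ) → KernelLinear r n h → KernelLinear r n (λ M → c ℤ.* h M)
KernelLinear-scale {r} {n} c h lin L inK = trans (evalComb-scale L) (trans (cong (c ℤ.*_) (lin L inK)) (ℤP.*-zeroʳ c))
  where
  evalComb-scale : ∀ (L : LinComb r n) → evalComb L (λ M → c ℤ.* h M) ≡ c ℤ.* evalComb L h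
  evalComb-scale [] = sym (ℤP.*-zeroʳ c)
  evalComb-scale ((a , M) ∷ L) = trans (cong (λ rest → a ℤ.* (c ℤ.* h (mat M)) ℤ.+ rest) (evalComb-scale L))
                                       (factor a c (h (mat M)) (evalComb L h))
    where
    factor : ∀ a c x y → a ℤ.* (c ℤ.* x) ℤ.+ c ℤ.* y ≡ c ℤ.* (a ℤ.* x ℤ.+ y)
    factor = solve-∀

KernelLinear-sumSubsets : ∀ {r n m} (h : Subset m → Matroid n → ℤ) → (∀ X → KernelLinear r n (h X)) →
  KernelLinear r n (λ M → sumSubsets (λ X → h X M))
KernelLinear-sumSubsets {r} {n} h lin L inK = trans (evalComb-sum h) (sumSubsets-zero _ (λ X → lin X L inK))
  where
  evalComb-+ : ∀ (L : LinComb r n) (g g' : Matroid n → ℤ) → evalComb L (λ M → g M ℤ.+ g' M) ≡ evalComb L g ℤ.+ evalComb L g'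
  evalComb-+ [] g g' = refl
  evalComb-+ ((a , M) ∷ L) g g' = trans (cong (λ rest → a ℤ.* (g (mat M) ℤ.+ g' (mat M)) ℤ.+ rest) (evalComb-+ L g g'))
                                        (distribute a (g (mat M)) (g' (mat M)) (evalComb L g) (evalComb L g'))
    where
    distribute : ∀ a x y u w → a ℤ.* (x ℤ.+ y) ℤ.+ (u ℤ.+ w) ≡ (a ℤ.* x ℤ.+ u) ℤ.+ (a ℤ.* y ℤ.+ w)
    distribute = solve-∀
  evalComb-sum : ∀ {m} (h : Subset m → Matroid n → ℤ) → evalComb L (λ M → sumSubsets (λ X → h X M)) ≡ sumSubsets (λ X → evalComb L (h X))
  evalComb-sum {zero} h = refl
  evalComb-sum {suc m} h = trans (evalComb-+ L _ _)
    (cong₂ ℤ._+_ (evalComb-sum (λ X → h (inside ∷ X))) (evalComb-sum (λ X → h (outside ∷ X))))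

KernelLinear-sumTuples : ∀ {r n} m (h : Vec (Subset n) m → Matroid n → ℤ) → (∀ v → KernelLinear r n (h v)) →
  KernelLinear r n (λ M → sumTuples m (λ v → h v M))
KernelLinear-sumTuples zero h lin = lin []
KernelLinear-sumTuples (suc m) h lin =
  KernelLinear-sumSubsets (λ X M → sumTuples m (λ v → h (X ∷ v) M)) (λ X → KernelLinear-sumTuples m _ (λ v → lin (X ∷ v)))

chainCoordinate-linear : ∀ {r n} (C : Fin r → Subset n) → IsChain C → KernelLinear r n (λ M → vCoord M C)
chainCoordinate-linear {r} {n} C chain L inK = trans (evalComb-coordinate L) (inK C chain)
  where
  evalComb-coordinate : ∀ (L : LinComb r n) → evalComb L (λ M → vCoord M C) ≡ sumℤ (List.map (λ { (a , M) → a ℤ.* vCoord (mat M) C }) L)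
  evalComb-coordinate [] = refl
  evalComb-coordinate ((a , M) ∷ L) = cong (λ rest → a ℤ.* vCoord (mat M) C ℤ.+ rest) (evalComb-coordinate L)

kernelLinear⇒InducesHom : ∀ {r n} (g : Matroid n → ℕ) → KernelLinear r n (λ M → + g M) → InducesHom r n g
kernelLinear⇒InducesHom {r} {n} g lin L inK = trans (sym (evalComb-sumℤ L)) (lin L inK)
  where
  evalComb-sumℤ : ∀ (L : LinComb r n) → evalComb L (λ M → + g M) ≡ sumℤ (List.map (λ { (a , M) → a ℤ.* + g (mat M) }) L)
  evalComb-sumℤ [] = refl
  evalComb-sumℤ ((a , M) ∷ L) = cong (λ rest → a ℤ.* + g (mat M) ℤ.+ rest) (evalComb-sumℤ L)

module _ {n : ℕ} where
  ∪-least : ∀ {A B C : Subset n} → A ⊆ C → B ⊆ C → A ∪ B ⊆ C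
  ∪-least {A} {B} A⊆C B⊆C x∈ with SP.x∈p∪q⁻ A B x∈
  ... | inj₁ x∈A = A⊆C x∈A
  ... | inj₂ x∈B = B⊆C x∈B

  ⊆-∪ˡ : ∀ {A B C : Subset n} → A ⊆ B → A ⊆ B ∪ C
  ⊆-∪ˡ {C = C} A⊆B x∈ = SP.p⊆p∪q C (A⊆B x∈)

  ⊆-∪ʳ : ∀ {A B C : Subset n} → A ⊆ C → A ⊆ B ∪ C
  ⊆-∪ʳ {B = B} {C} A⊆C x∈ = SP.q⊆p∪q B C (A⊆C x∈)

  ⊆-∩ : ∀ {A B C : Subset n} → A ⊆ B → A ⊆ C → A ⊆ B ∩ C
  ⊆-∩ A⊆B A⊆C x∈ = SP.x∈p∩q⁺ (A⊆B x∈ , A⊆C x∈)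

  ⁅⁆-⊆ : ∀ {e} {A : Subset n} → e ∈ A → ⁅ e ⁆ ⊆ A
  ⁅⁆-⊆ {e} e∈A x∈ rewrite SP.x∈⁅y⁆⇒x≡y e x∈ = e∈A

  ─-⊆ : ∀ {A B : Subset n} → A ─ B ⊆ A
  ─-⊆ {A} {B} = SP.p─q⊆p A B

∈─⁻ : ∀ {n} (p q : Subset n) {x : Fin n} → x ∈ p ─ q → x ∈ p × x ∉ q
∈─⁻ (s ∷ p) (inside ∷ q) {Fin.zero} ()
∈─⁻ (s ∷ p) (outside ∷ q) {Fin.zero} here = here , λ ()
∈─⁻ (s ∷ p) (t ∷ q) {Fin.suc x} (there x∈) with ∈─⁻ p q x∈
... | x∈p , x∉q = there x∈p , λ { (there x∈q) → x∉q x∈q }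

∈─⁺ : ∀ {n} {p q : Subset n} {x : Fin n} → x ∈ p → x ∉ q → x ∈ p ─ q
∈─⁺ = SP.x∈p∧x∉q⇒x∈p─q

card-remove : ∀ {n} (p : Subset n) {x : Fin n} → x ∈ p → ∣ p ∣ ≡ suc ∣ p - x ∣
card-remove (inside ∷ p) here = cong (suc ∘ ∣_∣) (sym (SP.p─⊥≡p p))
card-remove (inside ∷ p) (there x∈) = cong suc (card-remove p x∈)
card-remove (outside ∷ p) (there x∈) = card-remove p x∈

card-add : ∀ {n} (p : Subset n) (x : Fin n) → x ∉ p → ∣ p ∪ ⁅ x ⁆ ∣ ≡ suc ∣ p ∣
card-add (inside ∷ p) Fin.zero x∉ = absurd (x∉ here)
card-add (outside ∷ p) Fin.zero x∉ = cong (suc ∘ ∣_∣) (SP.∪-identityʳ p)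
card-add (inside ∷ p) (Fin.suc x) x∉ = cong suc (card-add p x (x∉ ∘ there))
card-add (outside ∷ p) (Fin.suc x) x∉ = card-add p x (x∉ ∘ there)

card≡0 : ∀ {n} (p : Subset n) → ∣ p ∣ ≡ 0 → p ≡ ∅
card≡0 [] _ = refl
card≡0 (outside ∷ p) ∣p∣≡0 = cong (outside ∷_) (card≡0 p ∣p∣≡0)

∈-tabulate⁻ : ∀ {n} (g : Fin n → Bool) {x} → x ∈ tabulate g → g x ≡ true
∈-tabulate⁻ g {x} x∈ = trans (sym (VecP.lookup∘tabulate g x)) (VecP.[]=⇒lookup x∈)

∈-tabulate⁺ : ∀ {n} (g : Fin n → Bool) {x} → g x ≡ true → x ∈ tabulate g
∈-tabulate⁺ g {x} gx = VecP.lookup⇒[]= x (tabulate g) (trans (VecP.lookup∘tabulate g x) gx)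

length-filter-tabulate : ∀ {n m} {P : Fin n → Set} (P? : ∀ x → Dec (P x)) (g : Fin m → Fin n) →
  length (filter P? (List.tabulate g)) ≡ ∣ tabulate (λ i → does (P? (g i))) ∣
length-filter-tabulate {m = zero} P? g = refl
length-filter-tabulate {m = suc m} P? g with does (P? (g Fin.zero))
... | true = cong suc (length-filter-tabulate P? (g ∘ Fin.suc))
... | false = length-filter-tabulate P? (g ∘ Fin.suc)

submod-strict : ∀ a b x y → a < b → b + x ≤ y + a → x < y
submod-strict a b x y a<b le = ℕP.+-cancelʳ-≤ a (suc x) y
  (ℕP.≤-trans (ℕP.≤-reflexive (cong suc (ℕP.+-comm x a))) (ℕP.≤-trans (ℕP.+-monoˡ-≤ x a<b) le))

module RankFacts {n : ℕ} (M : Matroid n) where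
  R : Subset n → ℕ
  R = rk M

  mono : ∀ {X Y} → X ⊆ Y → R X ≤ R Y
  mono {X} {Y} X⊆Y = rk-mono M X Y X⊆Y

  submod : ∀ A B {X Y} → X ⊆ A ∪ B → Y ⊆ A ∩ B → R X + R Y ≤ R A + R B
  submod A B X⊆ Y⊆ = ℕP.≤-trans (ℕP.+-mono-≤ (mono X⊆) (mono Y⊆)) (rk-submod M A B)

  rank-∅ : R ∅ ≡ 0
  rank-∅ = ℕP.n≤0⇒n≡0 (subst (R ∅ ≤_) (SP.∣⊥∣≡0 n) (rk-bound M ∅))

  rank-∪-bound : ∀ {X} A B → X ⊆ A ∪ B → R X ≤ R A + ∣ B ∣
  rank-∪-bound {X} A B X⊆ = ℕP.≤-trans (ℕP.m≤m+n (R X) (R (A ∩ B)))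
    (ℕP.≤-trans (submod A B X⊆ SP.⊆-refl) (ℕP.+-monoʳ-≤ (R A) (rk-bound M B)))

  rank-add-≤ : ∀ X e → R (X ∪ ⁅ e ⁆) ≤ suc (R X)
  rank-add-≤ X e = ℕP.≤-trans (rank-∪-bound X ⁅ e ⁆ SP.⊆-refl)
    (ℕP.≤-reflexive (trans (cong (λ m → R X + m) (SP.∣⁅x⁆∣≡1 e)) (ℕP.+-comm (R X) 1)))

  rank-add-outside-flat : ∀ {X t} e → X ⊆ t → IsFlat M t → e ∉ t → R X < R (X ∪ ⁅ e ⁆)
  rank-add-outside-flat {X} {t} e X⊆t flat e∉t = submod-strict (R t) (R (t ∪ ⁅ e ⁆)) (R X) (R (X ∪ ⁅ e ⁆))
    (flat e e∉t)
    (submod (X ∪ ⁅ e ⁆) t (∪-least (⊆-∪ʳ SP.⊆-refl) (⊆-∪ˡ (⊆-∪ʳ SP.⊆-refl))) (⊆-∩ (⊆-∪ˡ SP.⊆-refl) X⊆t))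

  flat-absorbs : ∀ {X Y} → X ⊆ Y → IsFlat M X → R Y ≤ R X → Y ⊆ X
  flat-absorbs {X} {Y} X⊆Y flat RY≤RX {y} y∈Y with y ∈? X
  ... | yes y∈X = y∈X
  ... | no y∉X = absurd (ℕP.<-irrefl refl (ℕP.<-≤-trans (flat y y∉X)
                   (ℕP.≤-trans (mono (∪-least X⊆Y (⁅⁆-⊆ y∈Y))) RY≤RX)))

  flat-⊂-rank : ∀ {X Y} → X ⊂ Y → IsFlat M X → R X < R Y
  flat-⊂-rank (X⊆Y , y , y∈Y , y∉X) flat = ℕP.<-≤-trans (flat y y∉X) (mono (∪-least X⊆Y (⁅⁆-⊆ y∈Y)))

  addAll : Subset n → List (Fin n) → Subset n
  addAll X [] = X
  addAll X (e ∷ l) = addAll X l ∪ ⁅ e ⁆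

  addAll-⊇ : ∀ X l → X ⊆ addAll X l
  addAll-⊇ X [] = SP.⊆-refl
  addAll-⊇ X (e ∷ l) = ⊆-∪ˡ (addAll-⊇ X l)

  addAll-∈⁺ : ∀ X l {e} → e ∈ₗ l → e ∈ addAll X l
  addAll-∈⁺ X (x ∷ l) (here refl) = SP.q⊆p∪q (addAll X l) ⁅ x ⁆ (SP.x∈⁅x⁆ x)
  addAll-∈⁺ X (x ∷ l) (there e∈l) = SP.p⊆p∪q ⁅ x ⁆ (addAll-∈⁺ X l e∈l)

  addAll-∈⁻ : ∀ X l {e} → e ∈ addAll X l → e ∈ X ⊎ e ∈ₗ l
  addAll-∈⁻ X [] e∈ = inj₁ e∈
  addAll-∈⁻ X (x ∷ l) e∈ with SP.x∈p∪q⁻ (addAll X l) ⁅ x ⁆ e∈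
  ... | inj₂ e∈x = inj₂ (here (SP.x∈⁅y⁆⇒x≡y x e∈x))
  ... | inj₁ e∈rest with addAll-∈⁻ X l e∈rest
  ...   | inj₁ e∈X = inj₁ e∈X
  ...   | inj₂ e∈l = inj₂ (there e∈l)

  addAll-rank : ∀ X l → (∀ {e} → e ∈ₗ l → R (X ∪ ⁅ e ⁆) ≡ R X) → R (addAll X l) ≤ R X
  addAll-rank X [] _ = ℕP.≤-refl
  addAll-rank X (e ∷ l) parallel = ℕP.+-cancelʳ-≤ (R X) _ (R X) (ℕP.≤-trans
     (submod (addAll X l) (X ∪ ⁅ e ⁆) (∪-least (⊆-∪ˡ SP.⊆-refl) (⊆-∪ʳ (⊆-∪ʳ SP.⊆-refl)))
                                      (⊆-∩ (addAll-⊇ X l) (⊆-∪ˡ SP.⊆-refl)))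
     (ℕP.+-mono-≤ (addAll-rank X l (parallel ∘ there)) (ℕP.≤-reflexive (parallel (here refl)))))

  Spans : Subset n → Fin n → Set
  Spans X e = R (X ∪ ⁅ e ⁆) ≡ R X

  spans? : ∀ X e → Dec (Spans X e)
  spans? X e = R (X ∪ ⁅ e ⁆) ℕ.≟ R X

  spanned : Subset n → List (Fin n)
  spanned X = filter (spans? X) (allFin n)

  closure : Subset n → Subset n
  closure X = addAll X (spanned X)

  closure-⊇ : ∀ X → X ⊆ closure X
  closure-⊇ X = addAll-⊇ X (spanned X)

  closure-rank : ∀ X → R (closure X) ≡ R X
  closure-rank X = ℕP.≤-antisym
    (addAll-rank X (spanned X) (λ e∈ → proj₂ (LMP.∈-filter⁻ (spans? X) {xs = allFin n} e∈)))
    (mono (closure-⊇ X))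

  closure-∈⁺ : ∀ X e → Spans X e → e ∈ closure X
  closure-∈⁺ X e spans = addAll-∈⁺ X (spanned X) (LMP.∈-filter⁺ (spans? X) (LMP.∈-allFin e) spans)

  closure-∈⁻ : ∀ X {e} → e ∈ closure X → e ∈ X ⊎ Spans X e
  closure-∈⁻ X e∈ with addAll-∈⁻ X (spanned X) e∈
  ... | inj₁ e∈X = inj₁ e∈X
  ... | inj₂ e∈l = inj₂ (proj₂ (LMP.∈-filter⁻ (spans? X) {xs = allFin n} e∈l))

  closure-flat : ∀ X → IsFlat M (closure X)
  closure-flat X e e∉ = subst (_< R (closure X ∪ ⁅ e ⁆)) (sym (closure-rank X))
    (ℕP.<-≤-trans (ℕP.≤∧≢⇒< (mono (⊆-∪ˡ SP.⊆-refl)) (λ eq → e∉ (closure-∈⁺ X e (sym eq))))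
                  (mono (∪-least (⊆-∪ˡ (closure-⊇ X)) (⊆-∪ʳ SP.⊆-refl))))

  closure-least : ∀ {X t} → X ⊆ t → IsFlat M t → closure X ⊆ t
  closure-least {X} {t} X⊆t flat {e} e∈ with closure-∈⁻ X e∈
  ... | inj₁ e∈X = X⊆t e∈X
  ... | inj₂ spans with e ∈? t
  ...   | yes e∈t = e∈t
  ...   | no e∉t = absurd (ℕP.<-irrefl (sym spans) (rank-add-outside-flat e X⊆t flat e∉t))

  ∅-flat : (∀ e → R ⁅ e ⁆ ≡ 1) → IsFlat M ∅
  ∅-flat loopless e _ = subst (_< R (∅ ∪ ⁅ e ⁆)) (sym rank-∅)
    (ℕP.<-≤-trans (subst (0 <_) (sym (loopless e)) (s≤s z≤n)) (mono (⊆-∪ʳ SP.⊆-refl)))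

Full-flat : ∀ {n} (M : Matroid n) → IsFlat M Full
Full-flat M e e∉ = absurd (e∉ SP.∈⊤)

-- A tuple (F₁,…,F_r) read as a flag: level j is F_j, with F₀ = ∅ and Full past the end.
entry : ∀ {n r} → Vec (Subset n) r → ℕ → Subset n
entry [] j = Full
entry (x ∷ v) zero = x
entry (x ∷ v) (suc j) = entry v j

level : ∀ {n r} → Vec (Subset n) r → ℕ → Subset n
level v zero = ∅
level v (suc j) = entry v j

entry-lookup : ∀ {n r} (v : Vec (Subset n) r) (i : Fin r) → lookup v i ≡ entry v (toℕ i)
entry-lookup (x ∷ v) Fin.zero = refl
entry-lookup (x ∷ v) (Fin.suc i) = entry-lookup v i

entry-tabulate : ∀ {n r} (g : Fin r → Subset n) j (j<r : j < r) → entry (tabulate g) j ≡ g (fromℕ< j<r)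
entry-tabulate {r = suc r} g zero _ = refl
entry-tabulate {r = suc r} g (suc j) (s≤s j<r) = entry-tabulate (g ∘ Fin.suc) j j<r

-- A step from P towards a target t must add the canonical element of t ∖ P
-- (the one chosen by nonempty?); if t ∖ P is empty, no step is possible.
Adds : ∀ {n} {X : Subset n} → Dec (Nonempty X) → Subset n → Set
Adds (yes (m , _)) G = m ∈ G
Adds (no _) G = False

adds? : ∀ {n} {X : Subset n} (d : Dec (Nonempty X)) (G : Subset n) → Dec (Adds d G)
adds? (yes (m , _)) G = m ∈? G
adds? (no _) G = no (λ ())

-- G is an admissible successor of P on the way to the target t; at a landmark (l = true)
-- the successor has to reach t.
Step : ∀ {n} → Subset n → Subset n → Subset n → Bool → Set
Step P G t l = P ⊆ G × G ⊆ t × Adds (nonempty? (t ─ P)) G × (l ≡ true → t ⊆ G)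

step? : ∀ {n} (P G t : Subset n) l → Dec (Step P G t l)
step? P G t l = (P ⊆? G) ×-dec (G ⊆? t) ×-dec adds? (nonempty? (t ─ P)) G ×-dec ((l Bool.≟ true) →-dec (t ⊆? G))

step-strict : ∀ {n} (P G t : Subset n) → P ⊆ G → Adds (nonempty? (t ─ P)) G → P ⊂ G
step-strict P G t P⊆G adds with nonempty? (t ─ P)
... | yes (m , m∈) = P⊆G , m , adds , proj₂ (∈─⁻ t P m∈)

FlatOfRank : ∀ {n} → Matroid n → Subset n → ℕ → Set
FlatOfRank M X j = IsFlat M X × rk M X ≡ j

flatOfRank? : ∀ {n} (M : Matroid n) (X : Subset n) (j : ℕ) → Dec (FlatOfRank M X j)
flatOfRank? M X j = isFlat? M X ×-dec (rk M X ℕ.≟ j)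

vCoord-cases : ∀ {r n} (M : Matroid n) (C : Fin r → Subset n) → vCoord M C ≡ + 0 ⊎ (∀ i → IsFlat M (C i))
vCoord-cases M C = cases (all? (λ i → isFlat? M (C i)))
  where
  cases : ∀ {P : Set} (d : Dec P) → 𝟙 d ≡ + 0 ⊎ P
  cases (yes p) = inj₂ p
  cases (no _) = inj₁ refl

-- A profile of rank r = r₀+1 consists of targets T j and a set of
-- landmark levels (always including r) such that T is increasing, T r = Full, and T is
-- constant between landmarks.  Summing the chain coordinates of the admissible flags
-- computes [every landmark T l is a flat of rank l], for every loopfree rank-r matroid.
module GreedyChains {n r₀ : ℕ} (target : ℕ → Subset n) (landmark : ℕ → Bool)
  (landmark-top : landmark (suc r₀) ≡ true) (target-top : target (suc r₀) ≡ Full)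
  (target-steady : ∀ j → 1 ≤ j → j < suc r₀ → landmark j ≡ false → target j ≡ target (suc j))
  (target-mono : ∀ j → target j ⊆ target (suc j)) where

  r : ℕ
  r = suc r₀

  StepAt : Vec (Subset n) r → ℕ → Set
  StepAt v j = Step (level v j) (level v (suc j)) (target (suc j)) (landmark (suc j))

  Admissible : Vec (Subset n) r → Set
  Admissible v = ∀ (i : Fin r) → StepAt v (toℕ i)

  admissible? : ∀ v → Dec (Admissible v)
  admissible? v = all? (λ i → step? (level v (toℕ i)) (level v (suc (toℕ i))) (target (suc (toℕ i))) (landmark (suc (toℕ i))))

  step-at : ∀ {v} → Admissible v → ∀ j → j < r → StepAt v j
  step-at {v} adm j j<r = subst (StepAt v) (FinP.toℕ-fromℕ< j<r) (adm (fromℕ< j<r))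

  level-strict : ∀ {v} → Admissible v → ∀ j → j < r → level v j ⊂ level v (suc j)
  level-strict {v} adm j j<r with step-at adm j j<r
  ... | P⊆G , _ , adds , _ = step-strict (level v j) (level v (suc j)) (target (suc j)) P⊆G adds

  levels-strict : ∀ {v} → Admissible v → ∀ a b → a < b → b ≤ r → level v a ⊂ level v b
  levels-strict adm a (suc b) (s≤s a≤b) b<r with ℕP.m≤n⇒m<n∨m≡n a≤b
  ... | inj₂ refl = level-strict adm a b<r
  ... | inj₁ a<b = SP.⊂-trans (levels-strict adm a b a<b (ℕP.≤-trans (ℕP.n≤1+n b) b<r)) (level-strict adm b b<r)

  top-level-full : ∀ {v} → Admissible v → level v r ≡ Full
  top-level-full adm with step-at adm r₀ (ℕP.n<1+n r₀)
  ... | _ , _ , _ , reaches = SP.⊆-antisym SP.⊆⊤ (subst (_⊆ _) target-top (reaches landmark-top))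

  admissible⇒chain : ∀ {v} → Admissible v → IsChain (lookup v)
  admissible⇒chain {v} adm = record
    { first-nonempty = λ i i≡0 → subst (∅ ⊂_) (sym (trans (entry-lookup v i) (cong (entry v) i≡0)))
                                       (level-strict adm 0 (s≤s z≤n))
    ; strict-incr = λ i j i<j → subst₂ _⊂_ (sym (entry-lookup v i)) (sym (entry-lookup v j))
        (levels-strict adm (suc (toℕ i)) (suc (toℕ j)) (s≤s i<j) (FinP.toℕ<n j))
    ; last-full = λ i i+1≡r → trans (entry-lookup v i) (trans (cong (level v) i+1≡r) (top-level-full adm))
    }

  greedyCount : Matroid n → ℤ
  greedyCount M = sumTuples r (λ v → 𝟙 (admissible? v) ℤ.* vCoord M (lookup v))

  greedyCount-linear : KernelLinear r n greedyCount
  greedyCount-linear = KernelLinear-sumTuples r _ (λ v → term-linear v (admissible? v))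
    where
    term-linear : ∀ v (d : Dec (Admissible v)) → KernelLinear r n (λ M → 𝟙 d ℤ.* vCoord M (lookup v))
    term-linear v (yes adm) = KernelLinear-scale (+ 1) _ (chainCoordinate-linear _ (admissible⇒chain adm))
    term-linear v (no _) = KernelLinear-ext (λ _ → + 0) _ (λ M → sym (ℤP.*-zeroˡ (vCoord (mat M) (lookup v))))
                                            KernelLinear-zero

  module Evaluate (M : Matroid n) (loopless : ∀ e → rk M ⁅ e ⁆ ≡ 1) (rank-r : rk M Full ≡ r) where
    open RankFacts M

    LandmarksFlat : Set
    LandmarksFlat = ∀ (i : Fin r) → landmark (suc (toℕ i)) ≡ true → FlatOfRank M (target (suc (toℕ i))) (suc (toℕ i))

    landmarksFlat? : Dec LandmarksFlat
    landmarksFlat? = all? (λ i → (landmark (suc (toℕ i)) Bool.≟ true) →-dec flatOfRank? M (target (suc (toℕ i))) (suc (toℕ i)))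

    landmark-flat : LandmarksFlat → ∀ l → 1 ≤ l → l ≤ r → landmark l ≡ true → FlatOfRank M (target l) l
    landmark-flat lf (suc l) _ l<r isLandmark = subst (λ k → FlatOfRank M (target (suc k)) (suc k)) (FinP.toℕ-fromℕ< l<r)
      (lf (fromℕ< l<r) (subst (λ k → landmark (suc k) ≡ true) (sym (FinP.toℕ-fromℕ< l<r)) isLandmark))

    FlagOfFlats : Vec (Subset n) r → Set
    FlagOfFlats v = ∀ i → IsFlat M (lookup v i)

    level-flat : ∀ {v} → FlagOfFlats v → ∀ j → j ≤ r → IsFlat M (level v j)
    level-flat flats zero _ = ∅-flat loopless
    level-flat {v} flats (suc j) j<r =
      subst (IsFlat M) (trans (entry-lookup v (fromℕ< j<r)) (cong (entry v) (FinP.toℕ-fromℕ< j<r))) (flats (fromℕ< j<r))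

    -- In an admissible flag of flats the ranks strictly increase from 0 to r, so level j has rank j.
    module _ {v} (adm : Admissible v) (flats : FlagOfFlats v) where
      rank-step : ∀ j → j < r → R (level v j) < R (level v (suc j))
      rank-step j j<r = flat-⊂-rank (level-strict adm j j<r) (level-flat flats j (ℕP.<⇒≤ j<r))

      level-rank-≥ : ∀ j → j ≤ r → j ≤ R (level v j)
      level-rank-≥ zero _ = z≤n
      level-rank-≥ (suc j) j<r = ℕP.≤-<-trans (level-rank-≥ j (ℕP.<⇒≤ j<r)) (rank-step j j<r)

      level-rank-room : ∀ d j → j + d ≡ r → R (level v j) + d ≤ r
      level-rank-room zero j j≡r rewrite ℕP.+-identityʳ j | j≡r | top-level-full adm | rank-r | ℕP.+-identityʳ r = ℕP.≤-refl
      level-rank-room (suc d) j j+d+1≡r = ℕP.≤-trans (ℕP.≤-reflexive (ℕP.+-suc (R (level v j)) d))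
        (ℕP.≤-trans (ℕP.+-monoˡ-≤ d (rank-step j j<r))
                    (level-rank-room d (suc j) (trans (sym (ℕP.+-suc j d)) j+d+1≡r)))
        where
        j<r : j < r
        j<r = subst (j <_) j+d+1≡r (ℕP.≤-trans (s≤s (ℕP.m≤m+n j d)) (ℕP.≤-reflexive (sym (ℕP.+-suc j d))))

      level-rank : ∀ j → j ≤ r → R (level v j) ≡ j
      level-rank j j≤r = ℕP.≤-antisym
        (ℕP.+-cancelʳ-≤ (r ∸ j) _ j (ℕP.≤-trans (level-rank-room (r ∸ j) j (ℕP.m+[n∸m]≡n j≤r))
                                                (ℕP.≤-reflexive (sym (ℕP.m+[n∸m]≡n j≤r)))))
        (level-rank-≥ j j≤r)

      -- at a landmark the flag meets its target, which is therefore a flat of the right rank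
      flag⇒landmarksFlat : LandmarksFlat
      flag⇒landmarksFlat i isLandmark with adm i
      ... | _ , G⊆t , _ , reaches = subst (λ X → FlatOfRank M X (suc (toℕ i))) (SP.⊆-antisym G⊆t (reaches isLandmark))
            (level-flat {v} flats (suc (toℕ i)) (FinP.toℕ<n i) , level-rank (suc (toℕ i)) (FinP.toℕ<n i))

    greedyStep : Subset n → ∀ {X : Subset n} → Dec (Nonempty X) → Subset n
    greedyStep P (yes (m , _)) = closure (P ∪ ⁅ m ⁆)
    greedyStep P (no _) = P

    greedy : ℕ → Subset n
    greedy zero = ∅
    greedy (suc j) = greedyStep (greedy j) (nonempty? (target (suc j) ─ greedy j))

    greedyFlag : Vec (Subset n) r
    greedyFlag = tabulate (λ i → greedy (suc (toℕ i)))

    level-greedyFlag : ∀ j → j ≤ r → level greedyFlag j ≡ greedy j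
    level-greedyFlag zero _ = refl
    level-greedyFlag (suc j) j<r = trans (entry-tabulate (λ i → greedy (suc (toℕ i))) j j<r)
                                         (cong (greedy ∘ suc) (FinP.toℕ-fromℕ< j<r))

    step-unique : ∀ P G t j → FlatOfRank M P j → FlatOfRank M G (suc j) → P ⊆ G →
      Adds (nonempty? (t ─ P)) G → G ≡ greedyStep P (nonempty? (t ─ P))
    step-unique P G t j (flatP , rankP) (flatG , rankG) P⊆G adds with nonempty? (t ─ P)
    ... | yes (m , m∈) = SP.⊆-antisym (flat-absorbs closure⊆G (closure-flat _) rankG≤) closure⊆G
      where
      closure⊆G : closure (P ∪ ⁅ m ⁆) ⊆ G
      closure⊆G = closure-least (∪-least P⊆G (⁅⁆-⊆ adds)) flatG
      rankG≤ : R G ≤ R (closure (P ∪ ⁅ m ⁆))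
      rankG≤ rewrite rankG | closure-rank (P ∪ ⁅ m ⁆) =
        subst (λ z → suc z ≤ R (P ∪ ⁅ m ⁆)) rankP (rank-add-outside-flat m SP.⊆-refl flatP (proj₂ (∈─⁻ t P m∈)))

    flag≡greedyFlag : ∀ {v} → Admissible v → FlagOfFlats v → v ≡ greedyFlag
    flag≡greedyFlag {v} adm flats =
      trans (sym (VecP.tabulate∘lookup v))
            (VecP.tabulate-cong (λ i → trans (entry-lookup v i) (level-greedy (suc (toℕ i)) (FinP.toℕ<n i))))
      where
      levelOfRank : ∀ j → j ≤ r → FlatOfRank M (level v j) j
      levelOfRank j j≤r = level-flat flats j j≤r , level-rank adm flats j j≤r
      level-greedy : ∀ j → j ≤ r → level v j ≡ greedy j
      level-greedy zero _ = refl
      level-greedy (suc j) j<r with step-at adm j j<r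
      ... | P⊆G , _ , adds , _ = trans
        (step-unique (level v j) (level v (suc j)) (target (suc j)) j (levelOfRank j (ℕP.<⇒≤ j<r)) (levelOfRank (suc j) j<r) P⊆G adds)
        (cong (λ P → greedyStep P (nonempty? (target (suc j) ─ P))) (level-greedy j (ℕP.<⇒≤ j<r)))

    next-landmark : ∀ d j → j + d ≡ r → 1 ≤ j → Σ ℕ (λ l → j ≤ l × l ≤ r × landmark l ≡ true × target j ≡ target l)
    next-landmark zero j j≡r _ rewrite ℕP.+-identityʳ j | j≡r = r , ℕP.≤-refl , ℕP.≤-refl , landmark-top , refl
    next-landmark (suc d) j j+d+1≡r 1≤j with landmark j in isLandmark
    ... | true = j , ℕP.≤-refl , ℕP.≤-trans (ℕP.m≤m+n j (suc d)) (ℕP.≤-reflexive j+d+1≡r) , isLandmark , refl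
    ... | false with next-landmark d (suc j) (trans (sym (ℕP.+-suc j d)) j+d+1≡r) (s≤s z≤n)
    ...   | l , j<l , l≤r , l-landmark , same = l , ℕP.≤-trans (ℕP.n≤1+n j) j<l , l≤r , l-landmark ,
              trans (target-steady j 1≤j j<r isLandmark) same
      where
      j<r : j < r
      j<r = subst (j <_) j+d+1≡r (ℕP.≤-trans (s≤s (ℕP.m≤m+n j d)) (ℕP.≤-reflexive (sym (ℕP.+-suc j d))))

    target-flat : LandmarksFlat → ∀ j → 1 ≤ j → j ≤ r → IsFlat M (target j) × j ≤ R (target j)
    target-flat lf j 1≤j j≤r with next-landmark (r ∸ j) j (ℕP.m+[n∸m]≡n j≤r) 1≤j
    ... | l , j≤l , l≤r , l-landmark , same with landmark-flat lf l (ℕP.≤-trans 1≤j j≤l) l≤r l-landmark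
    ...   | flat , rank rewrite same | rank = flat , j≤l

    greedy-step : ∀ P t (l : Bool) j → FlatOfRank M P j → P ⊆ t → IsFlat M t → suc j ≤ R t →
      (l ≡ true → R t ≡ suc j) →
      FlatOfRank M (greedyStep P (nonempty? (t ─ P))) (suc j) × greedyStep P (nonempty? (t ─ P)) ⊆ t ×
      Step P (greedyStep P (nonempty? (t ─ P))) t l
    greedy-step P t l j (flatP , rankP) P⊆t flatt j<Rt landmark-rank with nonempty? (t ─ P)
    ... | no empty = absurd (ℕP.<-irrefl refl (ℕP.<-≤-trans j<Rt (ℕP.≤-trans (mono t⊆P) (ℕP.≤-reflexive rankP))))
      where
      t⊆P : t ⊆ P
      t⊆P {y} y∈t with y ∈? P
      ... | yes y∈P = y∈P
      ... | no y∉P = absurd (empty (y , ∈─⁺ y∈t y∉P))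
    ... | yes (m , m∈) = (closure-flat _ , rankG) , G⊆t ,
        (SP.⊆-trans (⊆-∪ˡ SP.⊆-refl) (closure-⊇ _) , G⊆t , closure-⊇ _ (SP.q⊆p∪q P ⁅ m ⁆ (SP.x∈⁅x⁆ m)) ,
         λ isLandmark → flat-absorbs G⊆t (closure-flat _) (ℕP.≤-reflexive (trans (landmark-rank isLandmark) (sym rankG))))
      where
      m∈t×m∉P : m ∈ t × m ∉ P
      m∈t×m∉P = ∈─⁻ t P m∈
      rankG : R (closure (P ∪ ⁅ m ⁆)) ≡ suc j
      rankG = trans (closure-rank _) (ℕP.≤-antisym
        (subst (λ z → R (P ∪ ⁅ m ⁆) ≤ suc z) rankP (rank-add-≤ P m))
        (subst (λ z → suc z ≤ R (P ∪ ⁅ m ⁆)) rankP (rank-add-outside-flat m SP.⊆-refl flatP (proj₂ m∈t×m∉P))))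
      G⊆t : closure (P ∪ ⁅ m ⁆) ⊆ t
      G⊆t = closure-least (∪-least P⊆t (⁅⁆-⊆ (proj₁ m∈t×m∉P))) flatt

    module _ (lf : LandmarksFlat) where
      GreedyInvariant : ℕ → Set
      GreedyInvariant j = FlatOfRank M (greedy j) j × greedy j ⊆ target (suc j)

      greedy-advance : ∀ j → suc j ≤ r → GreedyInvariant j →
        GreedyInvariant (suc j) × Step (greedy j) (greedy (suc j)) (target (suc j)) (landmark (suc j))
      greedy-advance j j<r (ofRank , ⊆target) with target-flat lf (suc j) (s≤s z≤n) j<r
      ... | flatt , j<Rt with greedy-step (greedy j) (target (suc j)) (landmark (suc j)) j ofRank ⊆target flatt j<Rt
                               (λ isLandmark → proj₂ (landmark-flat lf (suc j) (s≤s z≤n) j<r isLandmark))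
      ...   | ofRank' , G⊆t , step = (ofRank' , SP.⊆-trans G⊆t (target-mono (suc j))) , step

      greedy-invariant : ∀ j → j ≤ r → GreedyInvariant j
      greedy-invariant zero _ = (∅-flat loopless , rank-∅) , SP.⊆-min _
      greedy-invariant (suc j) j<r = proj₁ (greedy-advance j j<r (greedy-invariant j (ℕP.<⇒≤ j<r)))

      greedyFlag-admissible : Admissible greedyFlag
      greedyFlag-admissible i = subst₂ (λ A B → Step A B (target (suc (toℕ i))) (landmark (suc (toℕ i))))
        (sym (level-greedyFlag (toℕ i) (ℕP.<⇒≤ (FinP.toℕ<n i)))) (sym (level-greedyFlag (suc (toℕ i)) (FinP.toℕ<n i)))
        (proj₂ (greedy-advance (toℕ i) (FinP.toℕ<n i) (greedy-invariant (toℕ i) (ℕP.<⇒≤ (FinP.toℕ<n i)))))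

      greedyFlag-flats : FlagOfFlats greedyFlag
      greedyFlag-flats i = subst (IsFlat M) (sym (VecP.lookup∘tabulate (λ i → greedy (suc (toℕ i))) i))
        (proj₁ (proj₁ (greedy-invariant (suc (toℕ i)) (FinP.toℕ<n i))))

    term-vanishes : ∀ v (d : Dec (Admissible v)) → (Admissible v → FlagOfFlats v → False) →
      𝟙 d ℤ.* vCoord M (lookup v) ≡ + 0
    term-vanishes v (no _) _ = ℤP.*-zeroˡ (vCoord M (lookup v))
    term-vanishes v (yes adm) excluded with vCoord-cases M (lookup v)
    ... | inj₁ coord≡0 rewrite coord≡0 = refl
    ... | inj₂ flats = absurd (excluded adm flats)

    greedyCount≡𝟙 : (d : Dec LandmarksFlat) → greedyCount M ≡ 𝟙 d
    greedyCount≡𝟙 (yes lf) = trans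
      (sumTuples-delta r _ greedyFlag (λ v v≢ → term-vanishes v (admissible? v) (λ adm flats → v≢ (flag≡greedyFlag adm flats))))
      (cong₂ ℤ._*_ (𝟙-yes (admissible? greedyFlag) (greedyFlag-admissible lf))
                   (𝟙-yes (all? (λ i → isFlat? M (lookup greedyFlag i))) (greedyFlag-flats lf)))
    greedyCount≡𝟙 (no ¬lf) = sumTuples-zero r _ (λ v → term-vanishes v (admissible? v) (λ adm flats → ¬lf (flag⇒landmarksFlat adm flats)))

does⇒ : ∀ {P : Set} (d : Dec P) → does d ≡ true → P
does⇒ (yes p) _ = p

does-false⇒ : ∀ {P : Set} (d : Dec P) → does d ≡ false → ¬ P
does-false⇒ (no ¬p) _ = ¬p

-- Constant functions are kernel-linear: with the single landmark r and target Full the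
-- greedy count of every loopfree rank-r matroid is 1.
constant-linear : ∀ {r₀ n} (c : ℤ) → KernelLinear (suc r₀) n (λ _ → c)
constant-linear {r₀} {n} c = KernelLinear-ext (λ M → c ℤ.* greedyCount M) (λ _ → c)
  (λ M → trans (cong (c ℤ.*_) (greedyCount≡1 M)) (ℤP.*-identityʳ c))
  (KernelLinear-scale c _ greedyCount-linear)
  where
  open GreedyChains {n} {r₀} (λ _ → Full) (λ j → does (j ℕ.≟ suc r₀))
    (dec-true (suc r₀ ℕ.≟ suc r₀) refl) refl (λ _ _ _ _ → refl) (λ _ → SP.⊆-refl)
  greedyCount≡1 : ∀ (M : LoopfreeMatroid (suc r₀) n) → greedyCount (mat M) ≡ + 1
  greedyCount≡1 M = trans (Evaluate.greedyCount≡𝟙 (mat M) (loopfree M) (rank-r M) landmarksFlat?) (𝟙-yes landmarksFlat? topFlat)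
    where
    open Evaluate (mat M) (loopfree M) (rank-r M) using (LandmarksFlat; landmarksFlat?)
    topFlat : LandmarksFlat
    topFlat i isTop = Full-flat (mat M) , trans (rank-r M) (sym (does⇒ (suc (toℕ i) ℕ.≟ suc r₀) isTop))

-- The flag indicator [D is a flat of rank d and F is a flat of rank k] for D ⊆ F and
-- 1 ≤ d ≤ k < r: the landmarks are d, k, r with targets D, F, Full.
module FlagProfile {n r₀ : ℕ} (d k : ℕ) (D F : Subset n) (1≤d : 1 ≤ d) (d≤k : d ≤ k) (k≤r₀ : k ≤ r₀)
  (D⊆F : D ⊆ F) (d≡k⇒D≡F : d ≡ k → D ≡ F) where

  choose : ∀ {A B : Set} → Dec A → Dec B → Subset n
  choose (yes _) _ = D
  choose (no _) (yes _) = F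
  choose (no _) (no _) = Full

  target : ℕ → Subset n
  target j = choose (j ≤? d) (j ≤? k)

  IsLandmark : ℕ → Set
  IsLandmark j = j ≡ d ⊎ j ≡ k ⊎ j ≡ suc r₀

  isLandmark? : ∀ j → Dec (IsLandmark j)
  isLandmark? j = (j ℕ.≟ d) ⊎-dec (j ℕ.≟ k) ⊎-dec (j ℕ.≟ suc r₀)

  landmark : ℕ → Bool
  landmark j = does (isLandmark? j)

  landmark⁺ : ∀ {j} → IsLandmark j → landmark j ≡ true
  landmark⁺ {j} = dec-true (isLandmark? j)

  landmark⁻ : ∀ {j} → landmark j ≡ true → IsLandmark j
  landmark⁻ {j} = does⇒ (isLandmark? j)

  not-landmark : ∀ {j} → landmark j ≡ false → ¬ IsLandmark j
  not-landmark {j} = does-false⇒ (isLandmark? j)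

  r≰d : ¬ (suc r₀ ≤ d)
  r≰d r≤d = ℕP.<-irrefl refl (ℕP.≤-trans r≤d (ℕP.≤-trans d≤k k≤r₀))

  r≰k : ¬ (suc r₀ ≤ k)
  r≰k r≤k = ℕP.<-irrefl refl (ℕP.≤-trans r≤k k≤r₀)

  target-top : target (suc r₀) ≡ Full
  target-top with suc r₀ ≤? d | suc r₀ ≤? k
  ... | yes r≤d | _ = absurd (r≰d r≤d)
  ... | no _ | yes r≤k = absurd (r≰k r≤k)
  ... | no _ | no _ = refl

  target-d : target d ≡ D
  target-d with d ≤? d
  ... | yes _ = refl
  ... | no d≰d = absurd (d≰d ℕP.≤-refl)

  target-k : target k ≡ F
  target-k with k ≤? d | k ≤? k
  ... | yes k≤d | _ = d≡k⇒D≡F (ℕP.≤-antisym d≤k k≤d)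
  ... | no _ | yes _ = refl
  ... | no _ | no k≰k = absurd (k≰k ℕP.≤-refl)

  choose-steady : ∀ j (a : Dec (j ≤ d)) (b : Dec (j ≤ k)) (a' : Dec (suc j ≤ d)) (b' : Dec (suc j ≤ k)) →
    j ≢ d → j ≢ k → choose a b ≡ choose a' b'
  choose-steady j (yes _) _ (yes _) _ _ _ = refl
  choose-steady j (yes j≤d) _ (no j≮d) _ j≢d _ = absurd (j≮d (ℕP.≤∧≢⇒< j≤d j≢d))
  choose-steady j (no j≰d) _ (yes j<d) _ _ _ = absurd (j≰d (ℕP.<⇒≤ j<d))
  choose-steady j (no _) (yes _) (no _) (yes _) _ _ = refl
  choose-steady j (no _) (yes j≤k) (no _) (no j≮k) _ j≢k = absurd (j≮k (ℕP.≤∧≢⇒< j≤k j≢k))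
  choose-steady j (no _) (no j≰k) (no _) (yes j<k) _ _ = absurd (j≰k (ℕP.<⇒≤ j<k))
  choose-steady j (no _) (no _) (no _) (no _) _ _ = refl

  target-steady : ∀ j → 1 ≤ j → j < suc r₀ → landmark j ≡ false → target j ≡ target (suc j)
  target-steady j _ _ notLandmark = choose-steady j (j ≤? d) (j ≤? k) (suc j ≤? d) (suc j ≤? k)
    (λ j≡d → not-landmark notLandmark (inj₁ j≡d)) (λ j≡k → not-landmark notLandmark (inj₂ (inj₁ j≡k)))

  choose-mono : ∀ j (a : Dec (j ≤ d)) (b : Dec (j ≤ k)) (a' : Dec (suc j ≤ d)) (b' : Dec (suc j ≤ k)) →
    choose a b ⊆ choose a' b'
  choose-mono j _ _ (no _) (no _) = SP.⊆⊤
  choose-mono j (yes _) _ (yes _) _ = SP.⊆-refl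
  choose-mono j (no j≰d) _ (yes j<d) _ = absurd (j≰d (ℕP.<⇒≤ j<d))
  choose-mono j (yes _) _ (no _) (yes _) = D⊆F
  choose-mono j (no _) (yes _) (no _) (yes _) = SP.⊆-refl
  choose-mono j (no _) (no j≰k) (no _) (yes j<k) = absurd (j≰k (ℕP.<⇒≤ j<k))

  target-mono : ∀ j → target j ⊆ target (suc j)
  target-mono j = choose-mono j (j ≤? d) (j ≤? k) (suc j ≤? d) (suc j ≤? k)

  open GreedyChains {n} {r₀} target landmark (landmark⁺ (inj₂ (inj₂ refl))) target-top target-steady target-mono public

  -- the landmark condition says exactly that D and F are flats of ranks d and k
  greedyCount≡flagIndicator : ∀ (M : LoopfreeMatroid (suc r₀) n) →
    greedyCount (mat M) ≡ 𝟙 (flatOfRank? (mat M) D d ×-dec flatOfRank? (mat M) F k)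
  greedyCount≡flagIndicator M = trans (greedyCount≡𝟙 landmarksFlat?)
    (𝟙-⇔ landmarksFlat? (flatOfRank? (mat M) D d ×-dec flatOfRank? (mat M) F k) landmarks⇒flag flag⇒landmarks)
    where
    open Evaluate (mat M) (loopfree M) (rank-r M) using (LandmarksFlat; landmarksFlat?; landmark-flat; greedyCount≡𝟙)
    landmarks⇒flag : LandmarksFlat → FlatOfRank (mat M) D d × FlatOfRank (mat M) F k
    landmarks⇒flag lf =
        subst (λ X → FlatOfRank (mat M) X d) target-d
          (landmark-flat lf d 1≤d (ℕP.≤-trans d≤k (ℕP.≤-trans k≤r₀ (ℕP.n≤1+n r₀))) (landmark⁺ (inj₁ refl)))
      , subst (λ X → FlatOfRank (mat M) X k) target-k
          (landmark-flat lf k (ℕP.≤-trans 1≤d d≤k) (ℕP.≤-trans k≤r₀ (ℕP.n≤1+n r₀)) (landmark⁺ (inj₂ (inj₁ refl))))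
    at : ∀ {j l} → j ≡ l → FlatOfRank (mat M) (target l) l → FlatOfRank (mat M) (target j) j
    at refl flat = flat
    flag⇒landmarks : FlatOfRank (mat M) D d × FlatOfRank (mat M) F k → LandmarksFlat
    flag⇒landmarks (flatD , flatF) i isLandmark with landmark⁻ {suc (toℕ i)} isLandmark
    ... | inj₁ i≡d = at i≡d (subst (λ X → FlatOfRank (mat M) X d) (sym target-d) flatD)
    ... | inj₂ (inj₁ i≡k) = at i≡k (subst (λ X → FlatOfRank (mat M) X k) (sym target-k) flatF)
    ... | inj₂ (inj₂ i≡r) = at i≡r (subst (λ X → FlatOfRank (mat M) X (suc r₀)) (sym target-top) (Full-flat (mat M) , rank-r M))

flagIndicator : ∀ {n} → Matroid n → ℕ → ℕ → Subset n → Subset n → ℤ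
flagIndicator M d k D F = 𝟙 (flatOfRank? M D d ×-dec flatOfRank? M F k)

flag-linear-interior : ∀ {n r₀} d k (D F : Subset n) → 1 ≤ d → d ≤ k → k ≤ r₀ → D ⊆ F → (d ≡ k → D ≡ F) →
  KernelLinear (suc r₀) n (λ M → flagIndicator M d k D F)
flag-linear-interior d k D F 1≤d d≤k k≤r₀ D⊆F d≡k⇒D≡F =
  KernelLinear-ext greedyCount _ greedyCount≡flagIndicator greedyCount-linear
  where open FlagProfile d k D F 1≤d d≤k k≤r₀ D⊆F d≡k⇒D≡F

_≟ₛ_ : ∀ {n} → (X Y : Subset n) → Dec (X ≡ Y)
_≟ₛ_ = VecP.≡-dec Bool._≟_

module Loopfree {r n : ℕ} (M : LoopfreeMatroid r n) where
  open RankFacts (mat M)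

  flatOfRank-0 : ∀ X → 𝟙 (flatOfRank? (mat M) X 0) ≡ 𝟙 (X ≟ₛ ∅)
  flatOfRank-0 X = 𝟙-⇔ (flatOfRank? (mat M) X 0) (X ≟ₛ ∅) rank0⇒∅ (λ { refl → ∅-flat (loopfree M) , rank-∅ })
    where
    rank0⇒∅ : FlatOfRank (mat M) X 0 → X ≡ ∅
    rank0⇒∅ (_ , rankX) = SP.Empty-unique (λ { (x , x∈X) → ℕP.<-irrefl refl
      (ℕP.≤-trans (ℕP.≤-reflexive (sym (loopfree M x))) (ℕP.≤-trans (mono (⁅⁆-⊆ x∈X)) (ℕP.≤-reflexive rankX))) })

  flatOfRank-top : ∀ X → 𝟙 (flatOfRank? (mat M) X r) ≡ 𝟙 (X ≟ₛ Full)
  flatOfRank-top X = 𝟙-⇔ (flatOfRank? (mat M) X r) (X ≟ₛ Full)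
    (λ { (flatX , rankX) → SP.⊆-antisym SP.⊆⊤ (flat-absorbs SP.⊆⊤ flatX (ℕP.≤-reflexive (trans (rank-r M) (sym rankX)))) })
    (λ { refl → Full-flat (mat M) , rank-r M })

  flatOfRank-beyond : ∀ X j → r < j → 𝟙 (flatOfRank? (mat M) X j) ≡ + 0
  flatOfRank-beyond X j r<j = 𝟙-no (flatOfRank? (mat M) X j) (λ { (_ , rankX) → ℕP.<-irrefl refl (ℕP.<-≤-trans r<j
     (ℕP.≤-trans (ℕP.≤-reflexive (sym rankX)) (ℕP.≤-trans (mono SP.⊆⊤) (ℕP.≤-reflexive (rank-r M))))) })

  nested-flats-equal : ∀ D F k → D ⊆ F → FlatOfRank (mat M) D k → FlatOfRank (mat M) F k → D ≡ F
  nested-flats-equal D F k D⊆F (flatD , rankD) (_ , rankF) =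
    SP.⊆-antisym D⊆F (flat-absorbs D⊆F flatD (ℕP.≤-reflexive (trans rankF (sym rankD))))

≰∧≢⇒> : ∀ {a b} → ¬ (a ≤ b) → ¬ (a ≡ suc b) → suc b < a
≰∧≢⇒> {a} {b} a≰b a≢b+1 with ℕP.m≤n⇒m<n∨m≡n (ℕP.≰⇒> a≰b)
... | inj₁ b+1<a = b+1<a
... | inj₂ b+1≡a = absurd (a≢b+1 (sym b+1≡a))

flatOfRank-linear : ∀ {n r₀} (X : Subset n) j → KernelLinear (suc r₀) n (λ M → 𝟙 (flatOfRank? M X j))
flatOfRank-linear X zero = KernelLinear-ext _ _ (λ M → sym (Loopfree.flatOfRank-0 M X)) (constant-linear _)
flatOfRank-linear {r₀ = r₀} X (suc j) with suc j ≤? r₀ | suc j ℕ.≟ suc r₀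
... | yes j<r₀ | _ = KernelLinear-ext _ _
      (λ M → 𝟙-⇔ (flatOfRank? (mat M) X (suc j) ×-dec flatOfRank? (mat M) X (suc j)) (flatOfRank? (mat M) X (suc j)) proj₁ (λ x → x , x))
      (flag-linear-interior (suc j) (suc j) X X (s≤s z≤n) ℕP.≤-refl j<r₀ SP.⊆-refl (λ _ → refl))
... | no _ | yes refl = KernelLinear-ext _ _ (λ M → sym (Loopfree.flatOfRank-top M X)) (constant-linear _)
... | no j≮r₀ | no j≢r₀ = KernelLinear-ext _ _ (λ M → sym (Loopfree.flatOfRank-beyond M X (suc j) (≰∧≢⇒> j≮r₀ j≢r₀))) KernelLinear-zero

-- Flag indicators are kernel-linear for all d ≤ k and D ⊆ F: the boundary ranks 0 and r
-- reduce to a single flatOfRank indicator, and rank beyond r gives 0.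
flag-linear : ∀ {n r₀} d k (D F : Subset n) → D ⊆ F → d ≤ k → KernelLinear (suc r₀) n (λ M → flagIndicator M d k D F)
flag-linear zero k D F D⊆F d≤k = KernelLinear-ext (λ M → 𝟙 (D ≟ₛ ∅) ℤ.* 𝟙 (flatOfRank? M F k)) _
  (λ M → sym (trans (𝟙-× (flatOfRank? (mat M) D 0) (flatOfRank? (mat M) F k))
                    (cong (ℤ._* 𝟙 (flatOfRank? (mat M) F k)) (Loopfree.flatOfRank-0 M D))))
  (KernelLinear-scale (𝟙 (D ≟ₛ ∅)) _ (flatOfRank-linear F k))
flag-linear {r₀ = r₀} (suc d) k D F D⊆F d≤k with k ≤? r₀
... | yes k≤r₀ with D ≟ₛ F
...   | yes D≡F = flag-linear-interior (suc d) k D F (s≤s z≤n) d≤k k≤r₀ D⊆F (λ _ → D≡F)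
...   | no D≢F with suc d ℕ.≟ k
...     | no d≢k = flag-linear-interior (suc d) k D F (s≤s z≤n) d≤k k≤r₀ D⊆F (λ d≡k → absurd (d≢k d≡k))
...     | yes refl = KernelLinear-ext (λ _ → + 0) _
          (λ M → sym (𝟙-no (flatOfRank? (mat M) D (suc d) ×-dec flatOfRank? (mat M) F (suc d))
                           (λ { (flatD , flatF) → D≢F (Loopfree.nested-flats-equal M D F (suc d) D⊆F flatD flatF) })))
          KernelLinear-zero
flag-linear {r₀ = r₀} (suc d) k D F D⊆F d≤k | no k≰r₀ with k ℕ.≟ suc r₀
... | yes refl = KernelLinear-ext (λ M → 𝟙 (F ≟ₛ Full) ℤ.* 𝟙 (flatOfRank? M D (suc d))) _
  (λ M → sym (trans (𝟙-× (flatOfRank? (mat M) D (suc d)) (flatOfRank? (mat M) F (suc r₀)))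
             (trans (cong (𝟙 (flatOfRank? (mat M) D (suc d)) ℤ.*_) (Loopfree.flatOfRank-top M F))
                    (ℤP.*-comm (𝟙 (flatOfRank? (mat M) D (suc d))) (𝟙 (F ≟ₛ Full))))))
  (KernelLinear-scale (𝟙 (F ≟ₛ Full)) _ (flatOfRank-linear D (suc d)))
... | no k≢r = KernelLinear-ext (λ _ → + 0) _
  (λ M → sym (trans (𝟙-× (flatOfRank? (mat M) D (suc d)) (flatOfRank? (mat M) F k))
             (trans (cong (𝟙 (flatOfRank? (mat M) D (suc d)) ℤ.*_) (Loopfree.flatOfRank-beyond M F k (≰∧≢⇒> k≰r₀ k≢r)))
                    (ℤP.*-zeroʳ (𝟙 (flatOfRank? (mat M) D (suc d)))))))
  KernelLinear-zero

-- signedBinom c m = (−1)^{m−c} binom(m,c), generated by the recursion below.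
signedBinom : ℕ → ℕ → ℤ
signedBinom zero zero = + 1
signedBinom (suc c) zero = + 0
signedBinom zero (suc m) = - signedBinom zero m
signedBinom (suc c) (suc m) = signedBinom c m ℤ.- signedBinom (suc c) m

-- Pascal's rule for the signed binomials, with signedBinom (−1) m read as 0.
pascalBelow : ℕ → ℕ → ℤ
pascalBelow zero m = + 0
pascalBelow (suc c) m = signedBinom c m

signedBinom-pascal : ∀ c m → signedBinom c (suc m) ℤ.+ signedBinom c m ≡ pascalBelow c m
signedBinom-pascal zero m = ℤP.+-inverseˡ (signedBinom zero m)
signedBinom-pascal (suc c) m = cancel (signedBinom c m) (signedBinom (suc c) m)
  where
  cancel : ∀ a b → a ℤ.- b ℤ.+ b ≡ a
  cancel = solve-∀

𝟙-⊆-inside : ∀ {n} (S K : Subset n) → 𝟙 (inside ∷ S ⊆? inside ∷ K) ≡ 𝟙 (S ⊆? K)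
𝟙-⊆-inside S K = 𝟙-⇔ (inside ∷ S ⊆? inside ∷ K) (S ⊆? K) SP.drop-∷-⊆ SP.s⊆s

𝟙-⊆-outside : ∀ {n} s (S K : Subset n) → 𝟙 (outside ∷ S ⊆? s ∷ K) ≡ 𝟙 (S ⊆? K)
𝟙-⊆-outside s S K = 𝟙-⇔ (outside ∷ S ⊆? s ∷ K) (S ⊆? K) SP.drop-∷-⊆ SP.out⊆

𝟙-⊆-inside-outside : ∀ {n} (S K : Subset n) → 𝟙 (inside ∷ S ⊆? outside ∷ K) ≡ + 0
𝟙-⊆-inside-outside S K = 𝟙-no (inside ∷ S ⊆? outside ∷ K) (λ S⊆K → outside-∌ (S⊆K here))
  where
  outside-∌ : Fin.zero ∈ outside ∷ K → False
  outside-∌ ()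

inclusion-exclusion : ∀ {n} (K : Subset n) c → sumSubsets (λ S → 𝟙 (S ⊆? K) ℤ.* signedBinom c ∣ S ∣) ≡ 𝟙 (∣ K ∣ ℕ.≟ c)
inclusion-exclusion [] zero = refl
inclusion-exclusion [] (suc c) = refl
inclusion-exclusion (inside ∷ K) c = begin
    sumSubsets (λ S → 𝟙 (inside ∷ S ⊆? inside ∷ K) ℤ.* signedBinom c (suc ∣ S ∣))
      ℤ.+ sumSubsets (λ S → 𝟙 (outside ∷ S ⊆? inside ∷ K) ℤ.* signedBinom c ∣ S ∣)
  ≡⟨ cong₂ ℤ._+_ (sumSubsets-cong _ _ (λ S → cong (ℤ._* signedBinom c (suc ∣ S ∣)) (𝟙-⊆-inside S K)))
                 (sumSubsets-cong _ _ (λ S → cong (ℤ._* signedBinom c ∣ S ∣) (𝟙-⊆-outside inside S K))) ⟩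
    sumSubsets (λ S → 𝟙 (S ⊆? K) ℤ.* signedBinom c (suc ∣ S ∣)) ℤ.+ sumSubsets (λ S → 𝟙 (S ⊆? K) ℤ.* signedBinom c ∣ S ∣)
  ≡⟨ sym (sumSubsets-+ (λ S → 𝟙 (S ⊆? K) ℤ.* signedBinom c (suc ∣ S ∣)) (λ S → 𝟙 (S ⊆? K) ℤ.* signedBinom c ∣ S ∣)) ⟩
    sumSubsets (λ S → 𝟙 (S ⊆? K) ℤ.* signedBinom c (suc ∣ S ∣) ℤ.+ 𝟙 (S ⊆? K) ℤ.* signedBinom c ∣ S ∣)
  ≡⟨ sumSubsets-cong _ _ (λ S → trans (sym (ℤP.*-distribˡ-+ (𝟙 (S ⊆? K)) _ _))
                                      (cong (𝟙 (S ⊆? K) ℤ.*_) (signedBinom-pascal c ∣ S ∣))) ⟩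
    sumSubsets (λ S → 𝟙 (S ⊆? K) ℤ.* pascalBelow c ∣ S ∣)
  ≡⟨ lower c ⟩
    𝟙 (suc ∣ K ∣ ℕ.≟ c) ∎
  where
  open ≡-Reasoning
  lower : ∀ c → sumSubsets (λ S → 𝟙 (S ⊆? K) ℤ.* pascalBelow c ∣ S ∣) ≡ 𝟙 (suc ∣ K ∣ ℕ.≟ c)
  lower zero = sumSubsets-zero _ (λ S → ℤP.*-zeroʳ (𝟙 (S ⊆? K)))
  lower (suc c) = trans (inclusion-exclusion K c) (𝟙-⇔ (∣ K ∣ ℕ.≟ c) (suc ∣ K ∣ ℕ.≟ suc c) (cong suc) ℕP.suc-injective)
inclusion-exclusion (outside ∷ K) c = begin
    sumSubsets (λ S → 𝟙 (inside ∷ S ⊆? outside ∷ K) ℤ.* signedBinom c (suc ∣ S ∣))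
      ℤ.+ sumSubsets (λ S → 𝟙 (outside ∷ S ⊆? outside ∷ K) ℤ.* signedBinom c ∣ S ∣)
  ≡⟨ cong₂ ℤ._+_ (sumSubsets-zero _ (λ S → cong (ℤ._* signedBinom c (suc ∣ S ∣)) (𝟙-⊆-inside-outside S K)))
                 (sumSubsets-cong _ _ (λ S → cong (ℤ._* signedBinom c ∣ S ∣) (𝟙-⊆-outside outside S K))) ⟩
    + 0 ℤ.+ sumSubsets (λ S → 𝟙 (S ⊆? K) ℤ.* signedBinom c ∣ S ∣)
  ≡⟨ ℤP.+-identityˡ _ ⟩
    sumSubsets (λ S → 𝟙 (S ⊆? K) ℤ.* signedBinom c ∣ S ∣)
  ≡⟨ inclusion-exclusion K c ⟩
    𝟙 (∣ K ∣ ℕ.≟ c) ∎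
  where open ≡-Reasoning

card-suc⇒element : ∀ {n} (S : Subset n) m → ∣ S ∣ ≡ suc m → ∃ λ e → e ∈ S
card-suc⇒element (inside ∷ S) m _ = Fin.zero , here
card-suc⇒element (outside ∷ S) m ∣S∣≡m+1 with card-suc⇒element S m ∣S∣≡m+1
... | e , e∈S = Fin.suc e , there e∈S

DeletionCondition : ∀ {n} → Matroid n → Subset n → Subset n → ℕ → Set
DeletionCondition M F S k = FlatOfRank M F k × FlatOfRank M (F ─ S) (k ∸ ∣ S ∣) × ∣ S ∣ ≤ k

deletionCondition? : ∀ {n} (M : Matroid n) (F S : Subset n) (k : ℕ) → Dec (DeletionCondition M F S k)
deletionCondition? M F S k = flatOfRank? M F k ×-dec flatOfRank? M (F ─ S) (k ∸ ∣ S ∣) ×-dec (∣ S ∣ ≤? k)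

coloopSet : ∀ {n} (M : Matroid n) (F : Subset n) → Subset n
coloopSet M F = tabulate (λ e → does (isColoopOfRestr? M F e))

numColoops≡∣coloopSet∣ : ∀ {n} (M : Matroid n) (F : Subset n) → numColoops M F ≡ ∣ coloopSet M F ∣
numColoops≡∣coloopSet∣ M F = length-filter-tabulate (isColoopOfRestr? M F) (λ i → i)

module Coloops {n : ℕ} (M : Matroid n) where
  open RankFacts M

  coloopSet-∈⁻ : ∀ {F e} → e ∈ coloopSet M F → IsColoopOfRestr M F e
  coloopSet-∈⁻ {F} {e} e∈ = does⇒ (isColoopOfRestr? M F e) (∈-tabulate⁻ _ e∈)

  coloopSet-∈⁺ : ∀ {F e} → IsColoopOfRestr M F e → e ∈ coloopSet M F
  coloopSet-∈⁺ {F} {e} coloop = ∈-tabulate⁺ _ (dec-true (isColoopOfRestr? M F e) coloop)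

  ⊆-delete-∪ : ∀ {F X : Subset n} {e} → e ∈ X → F ⊆ (F - e) ∪ X
  ⊆-delete-∪ {F} {X} {e} e∈X {y} y∈F with y FinP.≟ e
  ... | yes refl = SP.q⊆p∪q (F - e) X e∈X
  ... | no y≢e = SP.p⊆p∪q X (SP.x∈p∧x≢y⇒x∈p-y y∈F y≢e)

  coloop-restrict : ∀ {F X e} → X ⊆ F → e ∈ X → R (F - e) < R F → R (X - e) < R X
  coloop-restrict {F} {X} {e} X⊆F e∈X coloop = submod-strict (R (F - e)) (R F) (R (X - e)) (R X) coloop
    (ℕP.≤-trans (submod (F - e) X (⊆-delete-∪ e∈X)
                        (⊆-∩ (λ {y} y∈ → let (y∈X , y≢e) = ∈─⁻ X ⁅ e ⁆ y∈ in ∈─⁺ (X⊆F y∈X) y≢e) ─-⊆))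
                (ℕP.≤-reflexive (ℕP.+-comm (R (F - e)) (R X))))

  delete-coloops-rank : ∀ m F S → ∣ S ∣ ≡ m → S ⊆ F → (∀ {e} → e ∈ S → R (F - e) < R F) → R (F ─ S) + m ≤ R F
  delete-coloops-rank zero F S _ _ _ = ℕP.≤-trans (ℕP.≤-reflexive (ℕP.+-identityʳ _)) (mono ─-⊆)
  delete-coloops-rank (suc m) F S ∣S∣≡m+1 S⊆F coloops with card-suc⇒element S m ∣S∣≡m+1
  ... | e , e∈S = ℕP.≤-trans (ℕP.≤-reflexive (ℕP.+-suc (R (F ─ S)) m))
        (ℕP.≤-trans (ℕP.+-monoˡ-≤ m (ℕP.≤-trans (s≤s (mono F─S⊆X-e)) (coloop-restrict ─-⊆ e∈X (coloops e∈S))))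
          (delete-coloops-rank m F (S - e) ∣S-e∣≡m (SP.⊆-trans ─-⊆ S⊆F) (coloops ∘ ─-⊆)))
    where
    X = F ─ (S - e)
    ∣S-e∣≡m : ∣ S - e ∣ ≡ m
    ∣S-e∣≡m = ℕP.suc-injective (trans (sym (card-remove S e∈S)) ∣S∣≡m+1)
    e∈X : e ∈ X
    e∈X = ∈─⁺ (S⊆F e∈S) (λ e∈S-e → proj₂ (∈─⁻ S ⁅ e ⁆ e∈S-e) (SP.x∈⁅x⁆ e))
    F─S⊆X-e : F ─ S ⊆ X - e
    F─S⊆X-e {y} y∈ with ∈─⁻ F S y∈
    ... | y∈F , y∉S = ∈─⁺ (∈─⁺ y∈F (y∉S ∘ ─-⊆)) (λ y∈e → y∉S (subst (_∈ S) (sym (SP.x∈⁅y⁆⇒x≡y e y∈e)) e∈S))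

  delete-rank-≥ : ∀ F S → R F ≤ R (F ─ S) + ∣ S ∣
  delete-rank-≥ F S = rank-∪-bound (F ─ S) S F⊆
    where
    F⊆ : F ⊆ (F ─ S) ∪ S
    F⊆ {y} y∈F with y ∈? S
    ... | yes y∈S = SP.q⊆p∪q (F ─ S) S y∈S
    ... | no y∉S = SP.p⊆p∪q S (∈─⁺ y∈F y∉S)

  delete-coloops-flat : ∀ F S → IsFlat M F → S ⊆ F → (∀ {e} → e ∈ S → R (F - e) < R F) → IsFlat M (F ─ S)
  delete-coloops-flat F S flatF S⊆F coloops x x∉ with x ∈? F
  ... | no x∉F = rank-add-outside-flat x ─-⊆ flatF x∉F
  ... | yes x∈F with x ∈? S
  ...   | no x∉S = absurd (x∉ (∈─⁺ x∈F x∉S))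
  ...   | yes x∈S = submod-strict (R (F - x)) (R F) (R (F ─ S)) (R ((F ─ S) ∪ ⁅ x ⁆)) (coloops x∈S)
           (ℕP.≤-trans (submod (F - x) ((F ─ S) ∪ ⁅ x ⁆) (⊆-delete-∪ (SP.q⊆p∪q (F ─ S) ⁅ x ⁆ (SP.x∈⁅x⁆ x)))
                                (⊆-∩ F─S⊆F-x (⊆-∪ˡ SP.⊆-refl)))
                       (ℕP.≤-reflexive (ℕP.+-comm (R (F - x)) _)))
    where
    F─S⊆F-x : F ─ S ⊆ F - x
    F─S⊆F-x {y} y∈ with ∈─⁻ F S y∈
    ... | y∈F , y∉S = ∈─⁺ y∈F (λ y∈x → y∉S (subst (_∈ S) (sym (SP.x∈⁅y⁆⇒x≡y x y∈x)) x∈S))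

  coloops-from-rank : ∀ F S k → R F ≡ k → R (F ─ S) ≡ k ∸ ∣ S ∣ → ∣ S ∣ ≤ k → ∀ {e} → e ∈ S → R (F - e) < R F
  coloops-from-rank F S k rankF rankF─S ∣S∣≤k {e} e∈S = subst (R (F - e) <_) (sym rankF)
    (ℕP.≤-trans (s≤s (rank-∪-bound (F ─ S) (S - e) F-e⊆))
      (ℕP.≤-reflexive (trans (cong suc (cong (_+ ∣ S - e ∣) rankF─S)) (trans (sym (ℕP.+-suc (k ∸ ∣ S ∣) ∣ S - e ∣))
        (trans (cong (λ m → k ∸ ∣ S ∣ + m) (sym (card-remove S e∈S))) (ℕP.m∸n+n≡m ∣S∣≤k))))))
    where
    F-e⊆ : F - e ⊆ (F ─ S) ∪ (S - e)
    F-e⊆ {y} y∈ with ∈─⁻ F ⁅ e ⁆ y∈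
    ... | y∈F , y≢e with y ∈? S
    ...   | yes y∈S = SP.q⊆p∪q (F ─ S) (S - e) (∈─⁺ y∈S y≢e)
    ...   | no y∉S = SP.p⊆p∪q (S - e) (∈─⁺ y∈F y∉S)

  deletion-characterises-coloops : ∀ F k → FlatOfRank M F k → ∀ S →
    𝟙 ((S ⊆? F) ×-dec deletionCondition? M F S k) ≡ 𝟙 (S ⊆? coloopSet M F)
  deletion-characterises-coloops F k (flatF , rankF) S = 𝟙-⇔ ((S ⊆? F) ×-dec deletionCondition? M F S k) (S ⊆? coloopSet M F) to from
    where
    to : S ⊆ F × DeletionCondition M F S k → S ⊆ coloopSet M F
    to (S⊆F , _ , (_ , rankF─S) , ∣S∣≤k) e∈S = coloopSet-∈⁺ (S⊆F e∈S , coloops-from-rank F S k rankF rankF─S ∣S∣≤k e∈S)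
    from : S ⊆ coloopSet M F → S ⊆ F × DeletionCondition M F S k
    from S⊆K = (λ {x} → S⊆F {x}) , (flatF , rankF) , (delete-coloops-flat F S flatF S⊆F coloops , rankF─S) , ∣S∣≤k
      where
      S⊆F : S ⊆ F
      S⊆F e∈S = proj₁ (coloopSet-∈⁻ (S⊆K e∈S))
      coloops : ∀ {e} → e ∈ S → R (F - e) < R F
      coloops e∈S = proj₂ (coloopSet-∈⁻ (S⊆K e∈S))
      rank-sum : R (F ─ S) + ∣ S ∣ ≡ k
      rank-sum = trans (ℕP.≤-antisym (delete-coloops-rank ∣ S ∣ F S refl S⊆F coloops) (delete-rank-≥ F S)) rankF
      rankF─S : R (F ─ S) ≡ k ∸ ∣ S ∣
      rankF─S = trans (sym (ℕP.m+n∸n≡m (R (F ─ S)) ∣ S ∣)) (cong (_∸ ∣ S ∣) rank-sum)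
      ∣S∣≤k : ∣ S ∣ ≤ k
      ∣S∣≤k = subst (∣ S ∣ ≤_) rank-sum (ℕP.m≤n+m ∣ S ∣ (R (F ─ S)))

coloopExpansion : ∀ {n} → Matroid n → ℕ → ℕ → Subset n → ℤ
coloopExpansion M k c F = sumSubsets (λ S → signedBinom c ∣ S ∣ ℤ.* (𝟙 (S ⊆? F) ℤ.* 𝟙 (deletionCondition? M F S k)))

-- [F is a flat of rank k and M|F has exactly c coloops], by inclusion–exclusion over the coloops.
coloopCount-expansion : ∀ {n} (M : Matroid n) F k c →
  𝟙 (isFlat? M F ×-dec (rk M F ℕ.≟ k) ×-dec (numColoops M F ℕ.≟ c)) ≡ coloopExpansion M k c F
coloopCount-expansion M F k c with flatOfRank? M F k
... | yes flatF = begin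
    𝟙 (isFlat? M F ×-dec (rk M F ℕ.≟ k) ×-dec (numColoops M F ℕ.≟ c))
  ≡⟨ 𝟙-⇔ (isFlat? M F ×-dec (rk M F ℕ.≟ k) ×-dec (numColoops M F ℕ.≟ c)) (∣ coloopSet M F ∣ ℕ.≟ c)
         (λ (_ , _ , count) → trans (sym (numColoops≡∣coloopSet∣ M F)) count)
         (λ count → proj₁ flatF , proj₂ flatF , trans (numColoops≡∣coloopSet∣ M F) count) ⟩
    𝟙 (∣ coloopSet M F ∣ ℕ.≟ c)
  ≡⟨ sym (inclusion-exclusion (coloopSet M F) c) ⟩
    sumSubsets (λ S → 𝟙 (S ⊆? coloopSet M F) ℤ.* signedBinom c ∣ S ∣)
  ≡⟨ sumSubsets-cong _ _ (λ S → trans (ℤP.*-comm (𝟙 (S ⊆? coloopSet M F)) (signedBinom c ∣ S ∣))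
       (cong (signedBinom c ∣ S ∣ ℤ.*_) (trans (sym (Coloops.deletion-characterises-coloops M F k flatF S))
                                               (𝟙-× (S ⊆? F) (deletionCondition? M F S k))))) ⟩
    coloopExpansion M k c F ∎
  where open ≡-Reasoning
... | no ¬flatF = trans
  (𝟙-no (isFlat? M F ×-dec (rk M F ℕ.≟ k) ×-dec (numColoops M F ℕ.≟ c)) (λ (flat , rank , _) → ¬flatF (flat , rank)))
  (sym (sumSubsets-zero _ (λ S → begin
    signedBinom c ∣ S ∣ ℤ.* (𝟙 (S ⊆? F) ℤ.* 𝟙 (deletionCondition? M F S k))
  ≡⟨ cong (λ z → signedBinom c ∣ S ∣ ℤ.* (𝟙 (S ⊆? F) ℤ.* z)) (𝟙-no (deletionCondition? M F S k) (¬flatF ∘ proj₁)) ⟩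
    signedBinom c ∣ S ∣ ℤ.* (𝟙 (S ⊆? F) ℤ.* + 0)
  ≡⟨ cong (signedBinom c ∣ S ∣ ℤ.*_) (ℤP.*-zeroʳ (𝟙 (S ⊆? F))) ⟩
    signedBinom c ∣ S ∣ ℤ.* + 0
  ≡⟨ ℤP.*-zeroʳ (signedBinom c ∣ S ∣) ⟩
    + 0 ∎)))
  where open ≡-Reasoning

-- The deletion condition is a flag indicator (for D = F ∖ S ⊆ F), hence kernel-linear.
deletionCondition-linear : ∀ {n r₀} (F S : Subset n) k → KernelLinear (suc r₀) n (λ M → 𝟙 (deletionCondition? M F S k))
deletionCondition-linear F S k with ∣ S ∣ ≤? k
... | no ∣S∣≰k = KernelLinear-ext (λ _ → + 0) _
  (λ M → sym (𝟙-no (deletionCondition? (mat M) F S k) (∣S∣≰k ∘ proj₂ ∘ proj₂))) KernelLinear-zero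
... | yes ∣S∣≤k = KernelLinear-ext _ _
  (λ M → 𝟙-⇔ (flatOfRank? (mat M) (F ─ S) (k ∸ ∣ S ∣) ×-dec flatOfRank? (mat M) F k) (deletionCondition? (mat M) F S k)
              (λ (flatF─S , flatF) → flatF , flatF─S , ∣S∣≤k) (λ (flatF , flatF─S , _) → flatF─S , flatF))
  (flag-linear (k ∸ ∣ S ∣) k (F ─ S) F ─-⊆ (ℕP.m∸n≤m k ∣ S ∣))

coloopExpansion-linear : ∀ {n r₀} (F : Subset n) k c → KernelLinear (suc r₀) n (λ M → coloopExpansion M k c F)
coloopExpansion-linear F k c =
  KernelLinear-sumSubsets _ (λ S → KernelLinear-scale (signedBinom c ∣ S ∣) _ (KernelLinear-scale (𝟙 (S ⊆? F)) _
                                     (deletionCondition-linear F S k)))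

module CyclicFlats {n : ℕ} (M : Matroid n) where
  open RankFacts M
  open Coloops M

  no-coloops⇒count-0 : ∀ F → (∀ e → ¬ IsColoopOfRestr M F e) → numColoops M F ≡ 0
  no-coloops⇒count-0 F none = trans (numColoops≡∣coloopSet∣ M F)
    (ℕP.n≤0⇒n≡0 (ℕP.≤-trans (SP.p⊆q⇒∣p∣≤∣q∣ {p = coloopSet M F} {q = ∅} (λ e∈ → absurd (none _ (coloopSet-∈⁻ e∈))))
                            (ℕP.≤-reflexive (SP.∣⊥∣≡0 n))))

  count-0⇒no-coloops : ∀ F → numColoops M F ≡ 0 → ∀ e → ¬ IsColoopOfRestr M F e
  count-0⇒no-coloops F count≡0 e coloop =
    SP.∉⊥ (subst (e ∈_) (card≡0 (coloopSet M F) (trans (sym (numColoops≡∣coloopSet∣ M F)) count≡0)) (coloopSet-∈⁺ coloop))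

  -- an element of a circuit C ⊆ F is spanned by C − e ⊆ F − e, so it is not a coloop of M|F
  union-of-circuits⇒no-coloops : ∀ F → IsUnionOfCircuits M F → ∀ e → ¬ IsColoopOfRestr M F e
  union-of-circuits⇒no-coloops F circuits e (e∈F , coloop) with circuits e e∈F
  ... | C , C⊆F , e∈C , (dependent , minimal) = ℕP.<-irrefl refl (ℕP.<-≤-trans coloop
      (ℕP.+-cancelʳ-≤ (R (C - e)) (R F) (R (F - e))
        (ℕP.≤-trans (submod (F - e) C (⊆-delete-∪ e∈C) (⊆-∩ C-e⊆F-e ─-⊆)) (ℕP.+-monoʳ-≤ (R (F - e)) RC≤RC-e))))
    where
    C-e⊆F-e : C - e ⊆ F - e
    C-e⊆F-e {y} y∈ with ∈─⁻ C ⁅ e ⁆ y∈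
    ... | y∈C , y≢e = ∈─⁺ (C⊆F y∈C) y≢e
    RC≤RC-e : R C ≤ R (C - e)
    RC≤RC-e = ℕP.≤-pred (ℕP.≤-trans dependent
      (ℕP.≤-reflexive (trans (card-remove C e∈C) (cong suc (sym (minimal e e∈C))))))

  -- If e ∈ F is not a coloop of M|F, a minimal Z ⊆ F − e spanning e is independent and
  -- Z ∪ {e} is a circuit through e inside F.
  module CircuitThrough (F : Subset n) (e : Fin n) (e∈F : e ∈ F) (notColoop : ¬ (R (F - e) < R F)) where
    MinimalSpanning : Subset n → Set
    MinimalSpanning Z = Spans Z e × Z ⊆ F - e × (∀ z → z ∈ Z → ¬ Spans (Z - z) e)

    -- remove elements while the rest still spans e (induction on a bound for |Z|)
    shrink : ∀ m Z → ∣ Z ∣ ≤ m → Spans Z e → Z ⊆ F - e → Σ (Subset n) MinimalSpanning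
    shrink m Z ∣Z∣≤m spans Z⊆ with FinP.any? (λ z → (z ∈? Z) ×-dec spans? (Z - z) e)
    ... | no ¬removable = Z , spans , Z⊆ , (λ z z∈ spans' → ¬removable (z , z∈ , spans'))
    shrink zero Z ∣Z∣≤0 spans Z⊆ | yes (z , z∈ , _) =
      absurd (ℕP.<-irrefl refl (ℕP.≤-trans (ℕP.≤-reflexive (sym (card-remove Z z∈))) (ℕP.≤-trans ∣Z∣≤0 z≤n)))
    shrink (suc m) Z ∣Z∣≤m+1 spans Z⊆ | yes (z , z∈ , spans') =
      shrink m (Z - z) (ℕP.≤-pred (ℕP.≤-trans (ℕP.≤-reflexive (sym (card-remove Z z∈))) ∣Z∣≤m+1)) spans' (SP.⊆-trans ─-⊆ Z⊆)

    F-e-spans : Spans (F - e) e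
    F-e-spans = ℕP.≤-antisym (ℕP.≤-trans (mono (∪-least ─-⊆ (⁅⁆-⊆ e∈F))) (ℕP.≮⇒≥ notColoop)) (mono (⊆-∪ˡ SP.⊆-refl))

    Z : Subset n
    Z = proj₁ (shrink ∣ F - e ∣ (F - e) ℕP.≤-refl F-e-spans SP.⊆-refl)

    Z-minimal : MinimalSpanning Z
    Z-minimal = proj₂ (shrink ∣ F - e ∣ (F - e) ℕP.≤-refl F-e-spans SP.⊆-refl)

    Z-spans : Spans Z e
    Z-spans = proj₁ Z-minimal

    Z⊆F-e : Z ⊆ F - e
    Z⊆F-e = proj₁ (proj₂ Z-minimal)

    Z-z-misses : ∀ z → z ∈ Z → ¬ Spans (Z - z) e
    Z-z-misses = proj₂ (proj₂ Z-minimal)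

    e∉Z : e ∉ Z
    e∉Z e∈Z = proj₂ (∈─⁻ F ⁅ e ⁆ (Z⊆F-e e∈Z)) (SP.x∈⁅x⁆ e)

    -- by minimality every element of Z is a coloop of M|Z, so Z is independent
    Z-coloops : ∀ {z} → z ∈ Z → R (Z - z) < R Z
    Z-coloops {z} z∈ with R (Z - z) <? R Z
    ... | yes lt = lt
    ... | no ¬lt = absurd (Z-z-misses z z∈ (ℕP.≤-antisym
            (ℕP.≤-trans (mono (∪-least (⊆-∪ˡ ─-⊆) (⊆-∪ʳ SP.⊆-refl))) (ℕP.≤-trans (ℕP.≤-reflexive Z-spans) (ℕP.≮⇒≥ ¬lt)))
            (mono (⊆-∪ˡ SP.⊆-refl))))

    Z-independent : R Z ≡ ∣ Z ∣
    Z-independent = ℕP.≤-antisym (rk-bound M Z)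
      (ℕP.≤-trans (ℕP.m≤n+m ∣ Z ∣ (R (Z ─ Z))) (delete-coloops-rank ∣ Z ∣ Z Z refl SP.⊆-refl Z-coloops))

    C : Subset n
    C = Z ∪ ⁅ e ⁆

    ∣C∣ : ∣ C ∣ ≡ suc ∣ Z ∣
    ∣C∣ = card-add Z e e∉Z

    -- C − x is independent: for x = e it is Z, otherwise Z − x spans less than Z − x plus e
    C-x-independent : ∀ x → x ∈ C → ∣ Z ∣ ≤ R (C - x)
    C-x-independent x x∈C with x FinP.≟ e
    ... | yes refl = subst (_≤ R (C - x)) Z-independent
          (mono (λ {z} z∈ → ∈─⁺ (SP.p⊆p∪q ⁅ x ⁆ z∈) (λ z∈x → e∉Z (subst (_∈ Z) (SP.x∈⁅y⁆⇒x≡y x z∈x) z∈))))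
    ... | no x≢e = ℕP.≤-trans (ℕP.≤-reflexive (sym Z-independent))
                   (ℕP.≤-trans RZ≤ (ℕP.≤-trans grows (mono Z-x+e⊆C-x)))
      where
      x∈Z : x ∈ Z
      x∈Z with SP.x∈p∪q⁻ Z ⁅ e ⁆ x∈C
      ... | inj₁ x∈Z = x∈Z
      ... | inj₂ x∈e = absurd (x≢e (SP.x∈⁅y⁆⇒x≡y e x∈e))
      RZ≤ : R Z ≤ suc (R (Z - x))
      RZ≤ = ℕP.≤-trans (rank-∪-bound (Z - x) ⁅ x ⁆ (⊆-delete-∪ (SP.x∈⁅x⁆ x)))
              (ℕP.≤-reflexive (trans (cong (λ m → R (Z - x) + m) (SP.∣⁅x⁆∣≡1 x)) (ℕP.+-comm (R (Z - x)) 1)))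
      grows : suc (R (Z - x)) ≤ R ((Z - x) ∪ ⁅ e ⁆)
      grows = ℕP.≤∧≢⇒< (mono (⊆-∪ˡ SP.⊆-refl)) (λ eq → Z-z-misses x x∈Z (sym eq))
      Z-x+e⊆C-x : (Z - x) ∪ ⁅ e ⁆ ⊆ C - x
      Z-x+e⊆C-x = ∪-least (λ {y} y∈ → let (y∈Z , y∉x) = ∈─⁻ Z ⁅ x ⁆ y∈ in ∈─⁺ (SP.p⊆p∪q ⁅ e ⁆ y∈Z) y∉x)
                          (λ {y} y∈e → subst (_∈ C - x) (sym (SP.x∈⁅y⁆⇒x≡y e y∈e))
                              (∈─⁺ (SP.q⊆p∪q Z ⁅ e ⁆ (SP.x∈⁅x⁆ e)) (λ e∈x → x≢e (sym (SP.x∈⁅y⁆⇒x≡y x e∈x)))))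

    C-circuit : IsCircuit M C
    C-circuit = subst (_< ∣ C ∣) (sym (trans Z-spans Z-independent)) (ℕP.≤-reflexive (sym ∣C∣))
              , λ x x∈C → ℕP.≤-antisym (rk-bound M (C - x))
                  (subst (_≤ R (C - x)) (ℕP.suc-injective (trans (sym ∣C∣) (card-remove C x∈C))) (C-x-independent x x∈C))

    circuit : ∃ λ C' → C' ⊆ F × e ∈ C' × IsCircuit M C'
    circuit = C , ∪-least (SP.⊆-trans Z⊆F-e ─-⊆) (⁅⁆-⊆ e∈F) , SP.q⊆p∪q Z ⁅ e ⁆ (SP.x∈⁅x⁆ e) , C-circuit

  no-coloops⇒union-of-circuits : ∀ F → (∀ e → ¬ IsColoopOfRestr M F e) → IsUnionOfCircuits M F
  no-coloops⇒union-of-circuits F none e e∈F = CircuitThrough.circuit F e e∈F (λ coloop → none e (e∈F , coloop))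

  cyclic⇔no-coloops : ∀ F k → 𝟙 (isCyclicFlat? M F ×-dec (rk M F ℕ.≟ k)) ≡ 𝟙 (isFlat? M F ×-dec (rk M F ℕ.≟ k) ×-dec (numColoops M F ℕ.≟ 0))
  cyclic⇔no-coloops F k = 𝟙-⇔ (isCyclicFlat? M F ×-dec (rk M F ℕ.≟ k)) (isFlat? M F ×-dec (rk M F ℕ.≟ k) ×-dec (numColoops M F ℕ.≟ 0))
    (λ ((flat , circuits) , rank) → flat , rank , no-coloops⇒count-0 F (union-of-circuits⇒no-coloops F circuits))
    (λ (flat , rank , count≡0) → (flat , no-coloops⇒union-of-circuits F (count-0⇒no-coloops F count≡0)) , rank)

-- f_k(·; s, c) = Σ_F [|F| = s] · (coloop expansion of F).
f-linear : ∀ {n r₀} k s c → InducesHom (suc r₀) n (f k s c)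
f-linear {n} {r₀} k s c = kernelLinear⇒InducesHom (f k s c) (KernelLinear-ext expansion _ expansion≡f
  (KernelLinear-sumSubsets _ (λ F → KernelLinear-scale (𝟙 (∣ F ∣ ℕ.≟ s)) _ (coloopExpansion-linear F k c))))
  where
  expansion : Matroid n → ℤ
  expansion M = sumSubsets (λ F → 𝟙 (∣ F ∣ ℕ.≟ s) ℤ.* coloopExpansion M k c F)
  per-subset : ∀ (M : Matroid n) F →
    𝟙 (isFlat? M F ×-dec (∣ F ∣ ℕ.≟ s) ×-dec (rk M F ℕ.≟ k) ×-dec (numColoops M F ℕ.≟ c)) ≡ 𝟙 (∣ F ∣ ℕ.≟ s) ℤ.* coloopExpansion M k c F
  per-subset M F = begin
      𝟙 (isFlat? M F ×-dec (∣ F ∣ ℕ.≟ s) ×-dec (rk M F ℕ.≟ k) ×-dec (numColoops M F ℕ.≟ c))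
    ≡⟨ 𝟙-⇔ (isFlat? M F ×-dec (∣ F ∣ ℕ.≟ s) ×-dec (rk M F ℕ.≟ k) ×-dec (numColoops M F ℕ.≟ c)) ((∣ F ∣ ℕ.≟ s) ×-dec (isFlat? M F ×-dec (rk M F ℕ.≟ k) ×-dec (numColoops M F ℕ.≟ c)))
           (λ (flat , size , rest) → size , flat , rest) (λ (size , flat , rest) → flat , size , rest) ⟩
      𝟙 ((∣ F ∣ ℕ.≟ s) ×-dec (isFlat? M F ×-dec (rk M F ℕ.≟ k) ×-dec (numColoops M F ℕ.≟ c)))
    ≡⟨ 𝟙-× (∣ F ∣ ℕ.≟ s) (isFlat? M F ×-dec (rk M F ℕ.≟ k) ×-dec (numColoops M F ℕ.≟ c)) ⟩
      𝟙 (∣ F ∣ ℕ.≟ s) ℤ.* 𝟙 (isFlat? M F ×-dec (rk M F ℕ.≟ k) ×-dec (numColoops M F ℕ.≟ c))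
    ≡⟨ cong (𝟙 (∣ F ∣ ℕ.≟ s) ℤ.*_) (coloopCount-expansion M F k c) ⟩
      𝟙 (∣ F ∣ ℕ.≟ s) ℤ.* coloopExpansion M k c F ∎
    where open ≡-Reasoning
  expansion≡f : ∀ (M : LoopfreeMatroid (suc r₀) n) → expansion (mat M) ≡ + f k s c (mat M)
  expansion≡f M = sym (trans (countSubsets≡sum (λ F → isFlat? (mat M) F ×-dec (∣ F ∣ ℕ.≟ s) ×-dec (rk (mat M) F ℕ.≟ k)
                                                         ×-dec (numColoops (mat M) F ℕ.≟ c))) (sumSubsets-cong _ _ (per-subset (mat M))))

numFlats-linear : ∀ {n r₀} k → InducesHom (suc r₀) n (numFlats k)
numFlats-linear k = kernelLinear⇒InducesHom (numFlats k)
  (KernelLinear-ext _ _ (λ M → sym (countSubsets≡sum (λ F → flatOfRank? (mat M) F k)))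
                    (KernelLinear-sumSubsets _ (λ F → flatOfRank-linear F k)))

-- numCyclicFlats k = Σ_F [F is a flat of rank k and M|F has no coloops].
numCyclicFlats-linear : ∀ {n r₀} k → InducesHom (suc r₀) n (numCyclicFlats k)
numCyclicFlats-linear k = kernelLinear⇒InducesHom (numCyclicFlats k)
  (KernelLinear-ext _ _
    (λ M → sym (trans (countSubsets≡sum (λ F → isCyclicFlat? (mat M) F ×-dec (rk (mat M) F ℕ.≟ k))) (sumSubsets-cong _ _ (λ F →
              trans (CyclicFlats.cyclic⇔no-coloops (mat M) F k) (coloopCount-expansion (mat M) F k 0)))))
    (KernelLinear-sumSubsets _ (λ F → coloopExpansion-linear F k 0)))

corollary3p22 : (r n : ℕ) → 1 ≤ r → r ≤ n →
    (∀ k s c → InducesHom r n (f k s c))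
    × (∀ k → InducesHom r n (numFlats k))
    × (∀ k → InducesHom r n (numCyclicFlats k))
corollary3p22 (suc r₀) n _ _ = f-linear , numFlats-linear , numCyclicFlats-linear
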